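{- Let $G=(\mu;(a_1,b_1),\dots,(a_d,b_d))$ be bridge graph data of type $(k,n)$, and suppose there is a valid bridge diagram (for $(k,n)$) corresponding to $G$. Let $G'$ be obtained from $G$ by adding a lollipop: choose $q\in[n+1]$ and a color; replace every label $c\ge q$ (in $\mu$ and in all bridges) by $c+1$; and set $\mu'$ equal to the shifted $\mu$ together with $q$ if the lollipop is white (type $(k+1,n+1)$), or equal to the shifted $\mu$ if the lollipop is black (type $(k,n+1)$). Then there is a valid bridge diagram (for the type of $G'$) corresponding to $G'$.
   Context: Affine permutations: bijections $f:\mathbb{Z}\to\mathbb{Z}$ with $f(i+n)=f(i)+n$; a transposition $(a,b)$ swaps $a+sn$ and $b+sn$ for all $s$; $t_\mu(i)=i+n$ for $i\in\mu$, $t_\mu(i)=i$ for $i\in[n]\setminus\mu$, extended periodically. Bridge graph data of type $(k,n)$: a $k$-subset $\mu\subseteq[n]$ and pairs $(a_1,b_1),\dots,(a_d,b_d)$ with $1\le a_r<b_r\le n$ such that, with $f_0=t_\mu$ and $f_r=f_{r-1}\circ(a_r,b_r)$, for each $r$: (i) $f_{r-1}(a_r)>f_{r-1}(b_r)$; (ii) no $c$ with $a_r<c<b_r$ lies in $\{a_1,b_1,\dots,a_{r-1},b_{r-1}\}$; (iii) if $a_r$ is not among earlier bridge endpoints then $a_r\in\mu$, and if $b_r$ is not among earlier bridge endpoints then $b_r\notin\mu$. (This encodes a bridge graph: start with lollipops at $[n]$, white at $\mu$ and black elsewhere, and add bridges $(a_r,b_r)$ in order; a lollipop at $c$ means $c$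 is touched by no bridge.) Reduced words, PDS: for a reduced word $\mathbf{w}=s_{i_1}\cdots s_{i_m}$ and $J\subseteq[m]$, $u_{(j)}$ is the ordered product of letters at positions of $J$ up to $j$; $J$ is a positive distinguished subexpression (PDS) for $u=u_{(m)}$ if $u_{(j)}\le u_{(j-1)}s_{i_j}$ and $u_{(j-1)}<u_{(j-1)}s_{i_j}$ for all $j$. A valid bridge diagram for $(k,n)$ is the data of a reduced word $\mathbf{w}$ and the PDS $J$ for some $u$ anti-Grassmannian of type $(k,n)$ (decreasing on $[k]$ and on $[k+1,n]$). Its bridge sequence: for each $j\notin J$ the transposition $u_{(j-1)}s_{i_j}u_{(j-1)}^{ -1}=(a,b)$ with $a<b$, listed in order of decreasing $j$ (left to right in the diagram, where letters are drawn right to left). The valid bridge diagram corresponds to the bridge graph data $(u([k]);\text{its bridge sequence})$. -}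

module Defs where

open import Data.Nat as ℕ using (ℕ; zero; suc)
open import Data.Integer as ℤ using (ℤ; +_)
open import Data.Integer.Divisibility.Signed using (_∣_; _∣?_)
open import Data.Fin as F using (Fin; toℕ; inject₁; punchIn)
open import Data.Fin.Properties as FP using (any?)
open import Data.Fin.Subset as Sub using (Subset; ∣_∣)
open import Data.Fin.Subset.Properties as SubP using ()
open import Data.Vec using (insertAt)
open import Data.List as L using (List; []; _∷_; reverse; length; map)
open import Data.List.Membership.Propositional as LM using ()
open import Data.Bool using (Bool; true; false; if_then_else_; _∧_)
open import Data.Product using (Σ; ∃; _×_; _,_; proj₁; proj₂)
open import Data.Unit using (⊤)
open import Relation.Nullary using (¬_; Dec; yes; no; does)
open import Relation.Nullary.Decidable using (_×-dec_)
open import Relation.Binary.PropositionalEquality using (_≡_)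
open import Function.Bundles using (_⇔_)

-- Conventions: labels [n] = {1,…,n} are represented 0-indexed by Fin n
-- (label c ↔ toℕ c + 1); all order relations are preserved.

AffPerm : Set
AffPerm = ℤ → ℤ

_≡[mod_]?_ : (i : ℤ) (n : ℕ) (c : ℤ) → Dec ((+ n) ∣ (i ℤ.- c))
i ≡[mod n ]? c = (+ n) ∣? (i ℤ.- c)

fin→ℤ : ∀ {n} → Fin n → ℤ
fin→ℤ c = + toℕ c

affTransp : (n : ℕ) → Fin n → Fin n → AffPerm
affTransp n a b i =
  if does (i ≡[mod n ]? fin→ℤ a) then i ℤ.+ (fin→ℤ b ℤ.- fin→ℤ a)
  else if does (i ≡[mod n ]? fin→ℤ b) then i ℤ.- (fin→ℤ b ℤ.- fin→ℤ a)
  else i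

tμ : (n : ℕ) → Subset n → AffPerm
tμ n μ i =
  if does (any? (λ c → (c SubP.∈? μ) ×-dec (i ≡[mod n ]? fin→ℤ c)))
  then i ℤ.+ (+ n) else i

Bridge : ℕ → Set
Bridge n = Fin n × Fin n

-- f = f_{r-1}, E = endpoints of earlier bridges
BridgeSteps : (n : ℕ) → Subset n → AffPerm → List (Fin n) → List (Bridge n) → Set
BridgeSteps n μ f E [] = ⊤
BridgeSteps n μ f E ((a , b) ∷ rest) =
  (a F.< b)
  × (f (fin→ℤ b) ℤ.< f (fin→ℤ a))
  × (∀ c → a F.< c → c F.< b → ¬ (c LM.∈ E))
  × (¬ (a LM.∈ E) → a Sub.∈ μ)
  × (¬ (b LM.∈ E) → ¬ (b Sub.∈ μ))
  × BridgeSteps n μ (λ i → f (affTransp n a b i)) (a ∷ b ∷ E) rest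

BridgeGraphData : (k n : ℕ) → Subset n → List (Bridge n) → Set
BridgeGraphData k n μ bs = (∣ μ ∣ ≡ k) × BridgeSteps n μ (tμ n μ) [] bs

Perm : ℕ → Set
Perm n = Fin n → Fin n

_≗_ : ∀ {n} → Perm n → Perm n → Set
u ≗ v = ∀ x → u x ≡ v x

_·_ : ∀ {n} → Perm n → Perm n → Perm n
(u · v) x = u (v x)

idP : ∀ {n} → Perm n
idP x = x

swap : ∀ {n} → Fin n → Fin n → Perm n
swap a b x = if does (x F.≟ a) then b else if does (x F.≟ b) then a else x

record Letter (n : ℕ) : Set where
  constructor letter
  field idx : Fin (ℕ.pred n)

sgen : ∀ {n} → Letter n → Perm n
sgen {suc m} (letter i) = swap (inject₁ i) (F.suc i)

sumFin : (n : ℕ) → (Fin n → ℕ) → ℕ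
sumFin zero    f = 0
sumFin (suc n) f = f F.zero ℕ.+ sumFin n (λ x → f (F.suc x))

len : ∀ {n} → Perm n → ℕ
len {n} u = sumFin n (λ x → sumFin n (λ y →
              if does (x F.<? y) ∧ does (u y F.<? u x) then 1 else 0))

BruhatStep : ∀ {n} → Perm n → Perm n → Set
BruhatStep {n} u v = Σ (Fin n) λ a → Σ (Fin n) λ b →
  (a F.< b) × (v ≗ (u · swap a b)) × (len u ℕ.< len v)

data _≤B_ {n : ℕ} : Perm n → Perm n → Set where
  ≤B-refl : ∀ {u v} → u ≗ v → u ≤B v
  ≤B-step : ∀ {u w v} → BruhatStep u w → w ≤B v → u ≤B v

_<B_ : ∀ {n} → Perm n → Perm n → Set
u <B v = (u ≤B v) × ¬ (u ≗ v)

-- Reduced words with a subexpression J: a list of letters, each tagged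
-- with whether its position lies in J.

Diagram : ℕ → Set
Diagram n = List (Letter n × Bool)

word : ∀ {n} → Diagram n → List (Letter n)
word = map proj₁

wordProd : ∀ {n} → List (Letter n) → Perm n
wordProd []       = idP
wordProd (i ∷ is) = sgen i · wordProd is

IsReduced : ∀ {n} → List (Letter n) → Set
IsReduced w = len (wordProd w) ≡ length w

nextU : ∀ {n} → Perm n → Letter n × Bool → Perm n
nextU u (i , true)  = u · sgen i
nextU u (i , false) = u

finalU : ∀ {n} → Perm n → Diagram n → Perm n
finalU u []       = u
finalU u (l ∷ ls) = finalU (nextU u l) ls

subexprProd : ∀ {n} → Diagram n → Perm n
subexprProd = finalU idP

PDSfrom : ∀ {n} → Perm n → Diagram n → Set
PDSfrom u [] = ⊤
PDSfrom u ((i , b) ∷ ls) =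
  (nextU u (i , b) ≤B (u · sgen i)) × (u <B (u · sgen i)) × PDSfrom (nextU u (i , b)) ls

IsPDS : ∀ {n} → Diagram n → Set
IsPDS = PDSfrom idP

AntiGrassmannian : (k n : ℕ) → Perm n → Set
AntiGrassmannian k n u =
  (∀ x y → x F.< y → toℕ y ℕ.< k → u y F.< u x)
  × (∀ x y → x F.< y → k ℕ.≤ toℕ x → u y F.< u x)

ValidBridgeDiagram : (k n : ℕ) → Diagram n → Set
ValidBridgeDiagram k n D =
  IsReduced (word D) × IsPDS D × AntiGrassmannian k n (subexprProd D)

-- the transposition u s_i u⁻¹ = (u(i), u(i+1)), written (a,b) with a < b
conjPair : ∀ {n} → Perm n → Letter n → Bridge n
conjPair {suc m} u (letter i) =
  let p = u (inject₁ i) ; q = u (F.suc i) in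
  if does (p F.<? q) then (p , q) else (q , p)

bridgesFrom : ∀ {n} → Perm n → Diagram n → List (Bridge n)
bridgesFrom u [] = []
bridgesFrom u ((i , true)  ∷ ls) = bridgesFrom (u · sgen i) ls
bridgesFrom u ((i , false) ∷ ls) = conjPair u i ∷ bridgesFrom u ls

bridgeSequence : ∀ {n} → Diagram n → List (Bridge n)
bridgeSequence D = reverse (bridgesFrom idP D)

Corresponds : (k n : ℕ) → Diagram n → Subset n → List (Bridge n) → Set
Corresponds k n D μ bs =
  (∀ c → (c Sub.∈ μ) ⇔ (∃ λ x → (toℕ x ℕ.< k) × (subexprProd D x ≡ c)))
  × (bridgeSequence D ≡ bs)

HasValidDiagram : (k n : ℕ) → Subset n → List (Bridge n) → Set
HasValidDiagram k n μ bs =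
  ∃ λ (D : Diagram n) → ValidBridgeDiagram k n D × Corresponds k n D μ bs

shiftLabel : ∀ {n} → Fin (suc n) → Fin n → Fin (suc n)
shiftLabel q c = punchIn q c

shiftBridges : ∀ {n} → Fin (suc n) → List (Bridge n) → List (Bridge (suc n))
shiftBridges q = map (λ { (a , b) → (shiftLabel q a , shiftLabel q b) })

-- white = true: μ' = shifted μ ∪ {q};  white = false: μ' = shifted μ
lollipopSubset : ∀ {n} → Subset n → Fin (suc n) → Bool → Subset (suc n)
lollipopSubset μ q white = insertAt μ q (if white then Sub.inside else Sub.outside)

lollipopK : ℕ → Bool → ℕ
lollipopK k white = if white then suc k else k

-- A valid diagram D consists of a reduced word w and a positive
-- distinguished subexpression J for an anti-Grassmannian permutation U.
-- Both conditions say that every letter is an ascent of the running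
-- product (of w, resp. of J); we work with these "ascending" forms.
-- Given the new value q and a position p of [n+1], the graft of a
-- permutation v of [n] sends p ↦ q and punchIn p y ↦ punchIn q (v y).
-- Relabelling every letter of D along punchIn p (p = 0 for a white and
-- p = n for a black lollipop) grafts every running product, so it keeps D
-- ascending and shifts all bridges by q.  We put in front a word of
-- J-letters sliding the value q from position q to p, and behind it a word
-- of J-letters sliding it from p to a cut position P' where the graft of U
-- becomes anti-Grassmannian of the new type.  These letters are ascents for
-- the J-product since q only passes over values lying on the correct side
-- of q; for the product W of w this follows from U ≤ W in Bruhat order,
-- used in the form of the counting inequalities `Dominated`, which are
-- preserved along every PDS.  The appended letters create no bridges, and the new
-- subexpression product sends [k] (resp. [k+1]) onto μ with q inserted.
module Submission where

open import Defs
open import Data.Nat as ℕ using (ℕ; zero; suc; _+_; _∸_; z≤n; s≤s)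
import Data.Nat.Properties as NP
open import Data.Fin as F using (Fin; toℕ; inject₁; punchIn; punchOut; fromℕ<; fromℕ)
import Data.Fin.Properties as FP
open import Data.Bool using (Bool; true; false; if_then_else_; _∧_)
open import Data.Product using (Σ; ∃; _×_; _,_; proj₁; proj₂)
open import Data.Sum using (_⊎_; inj₁; inj₂)
open import Data.Empty using (⊥-elim)
open import Data.Unit using (⊤; tt)
open import Data.List using (List; []; _∷_; _++_; map; reverse; length)
import Data.List.Properties as LP
open import Relation.Nullary using (¬_; Dec; yes; no; does)
open import Relation.Nullary.Decidable using (dec-true; dec-false; does-⇔)
open import Relation.Binary.Definitions using (tri<; tri≈; tri>)
open import Data.Vec using (lookup; insertAt)
import Data.Vec.Properties as VP
import Data.Fin.Subset as Sub
open import Data.Fin.Subset using (Subset)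
import Data.Fin.Subset.Properties as SubP
open import Function.Bundles using (_⇔_; mk⇔; Equivalence)
open import Relation.Binary.PropositionalEquality hiding (_≗_)
open import Algebra.Properties.CommutativeSemigroup NP.+-commutativeSemigroup using (x∙yz≈y∙xz)

ind : Bool → ℕ
ind b = if b then 1 else 0

ind-false : ∀ {b c : Bool} → b ≡ false → ind (b ∧ c) ≡ 0
ind-false refl = refl

ind-false′ : ∀ {b c : Bool} → c ≡ false → ind (b ∧ c) ≡ 0
ind-false′ {true} refl = refl
ind-false′ {false} refl = refl

ind-true : ∀ {b} (c : Bool) → b ≡ true → ind (b ∧ c) ≡ ind c
ind-true c refl = refl

ind≤1 : ∀ b → ind b ℕ.≤ 1
ind≤1 true = NP.≤-refl
ind≤1 false = z≤n

ind-mono : ∀ (b c : Bool) → (b ≡ true → c ≡ true) → ind b ℕ.≤ ind c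
ind-mono true c f rewrite f refl = NP.≤-refl
ind-mono false c f = z≤n

ind-forced : ∀ b {x y} → suc x ℕ.≤ ind b + y → y ℕ.≤ x → b ≡ true × x ℕ.≤ y
ind-forced true (s≤s p) q = refl , p
ind-forced false p q = ⊥-elim (NP.<-irrefl refl (NP.<-≤-trans p q))

does-true→ : ∀ {P : Set} (d : Dec P) → does d ≡ true → P
does-true→ (yes p) _ = p

does-false→ : ∀ {P : Set} (d : Dec P) → does d ≡ false → ¬ P
does-false→ (no np) _ = np

does-↔ : ∀ {P Q : Set} (p : Dec P) (q : Dec Q) → (P → Q) → (Q → P) → does p ≡ does q
does-↔ p q f g = does-⇔ (mk⇔ f g) p q

swap-left : ∀ {n} (a b : Fin n) → swap a b a ≡ b
swap-left a b with a F.≟ a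
... | yes _ = refl
... | no ne = ⊥-elim (ne refl)

swap-right : ∀ {n} (a b : Fin n) → swap a b b ≡ a
swap-right a b with b F.≟ a
... | yes refl = refl
... | no _ with b F.≟ b
...   | yes _ = refl
...   | no ne = ⊥-elim (ne refl)

swap-other : ∀ {n} (a b x : Fin n) → x ≢ a → x ≢ b → swap a b x ≡ x
swap-other a b x na nb with x F.≟ a
... | yes e = ⊥-elim (na e)
... | no _ with x F.≟ b
...   | yes e = ⊥-elim (nb e)
...   | no _ = refl

swap-involutive : ∀ {n} (a b x : Fin n) → swap a b (swap a b x) ≡ x
swap-involutive a b x = by-cases (x F.≟ a) (x F.≟ b)
  where
  by-cases : Dec (x ≡ a) → Dec (x ≡ b) → swap a b (swap a b x) ≡ x
  by-cases (yes refl) _ = trans (cong (swap x b) (swap-left x b)) (swap-right x b)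
  by-cases (no _) (yes refl) = trans (cong (swap a x) (swap-right a x)) (swap-left a x)
  by-cases (no na) (no nb) = trans (cong (swap a b) (swap-other a b x na nb)) (swap-other a b x na nb)

swap-natural : ∀ {m n} (f : Fin m → Fin n) → (∀ {x y} → f x ≡ f y → x ≡ y) →
               ∀ a b x → swap (f a) (f b) (f x) ≡ f (swap a b x)
swap-natural f inj a b x = by-cases (x F.≟ a) (x F.≟ b)
  where
  by-cases : Dec (x ≡ a) → Dec (x ≡ b) → swap (f a) (f b) (f x) ≡ f (swap a b x)
  by-cases (yes refl) _ = trans (swap-left (f x) (f b)) (cong f (sym (swap-left x b)))
  by-cases (no _) (yes refl) = trans (swap-right (f a) (f x)) (cong f (sym (swap-right a x)))
  by-cases (no na) (no nb) = trans (swap-other (f a) (f b) (f x) (λ e → na (inj e)) (λ e → nb (inj e)))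
                                   (cong f (sym (swap-other a b x na nb)))

lo : ∀ {n} → Letter n → Fin n
lo {suc m} (letter i) = inject₁ i

hi : ∀ {n} → Letter n → Fin n
hi {suc m} (letter i) = F.suc i

sgen-swap : ∀ {n} (l : Letter n) x → sgen l x ≡ swap (lo l) (hi l) x
sgen-swap {suc m} (letter i) x = refl

toℕ-hi : ∀ {n} (l : Letter n) → toℕ (hi l) ≡ suc (toℕ (lo l))
toℕ-hi {suc m} (letter i) = cong suc (sym (FP.toℕ-inject₁ i))

lo<hi : ∀ {n} (l : Letter n) → lo l F.< hi l
lo<hi l = subst (toℕ (lo l) ℕ.<_) (sym (toℕ-hi l)) (NP.n<1+n _)

swap-monotone : ∀ {n} (l : Letter n) {x y : Fin n} → x F.< y → ¬ (x ≡ lo l × y ≡ hi l) →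
                swap (lo l) (hi l) x F.< swap (lo l) (hi l) y
swap-monotone l {x} {y} x<y not-ab = by-cases (x F.≟ a) (x F.≟ b) (y F.≟ a) (y F.≟ b)
  where
  a = lo l
  b = hi l
  s = swap a b
  r = toℕ a
  tb : toℕ b ≡ suc r
  tb = toℕ-hi l
  at-a : ∀ {z} → z ≡ a → toℕ (s z) ≡ suc r
  at-a e = trans (cong toℕ (trans (cong s e) (swap-left a b))) tb
  at-b : ∀ {z} → z ≡ b → toℕ (s z) ≡ r
  at-b e = cong toℕ (trans (cong s e) (swap-right a b))
  elsewhere : ∀ {z} → z ≢ a → z ≢ b → toℕ (s z) ≡ toℕ z
  elsewhere na nb = cong toℕ (swap-other a b _ na nb)
  via : ∀ {X Y} → toℕ (s x) ≡ X → toℕ (s y) ≡ Y → X ℕ.< Y → s x F.< s y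
  via refl refl lt = lt
  x<y′ : toℕ x ℕ.< toℕ y
  x<y′ = x<y
  by-cases : Dec (x ≡ a) → Dec (x ≡ b) → Dec (y ≡ a) → Dec (y ≡ b) → s x F.< s y
  by-cases (yes xa) _ _ (yes yb) = ⊥-elim (not-ab (xa , yb))
  by-cases (yes xa) _ (yes ya) _ = ⊥-elim (NP.<-irrefl (cong toℕ (trans xa (sym ya))) x<y)
  by-cases (yes xa) _ (no ya) (no yb) =
    via (at-a xa) (elsewhere ya yb)
        (NP.≤∧≢⇒< (subst (ℕ._< toℕ y) (cong toℕ xa) x<y′) (λ e → yb (FP.toℕ-injective (trans (sym e) (sym tb)))))
  by-cases (no _) (yes xb) (yes ya) _ =
    ⊥-elim (NP.<-asym (lo<hi l) (subst₂ F._<_ xb ya x<y))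
  by-cases (no _) (yes xb) _ (yes yb) = ⊥-elim (NP.<-irrefl (cong toℕ (trans xb (sym yb))) x<y)
  by-cases (no _) (yes xb) (no ya) (no yb) =
    via (at-b xb) (elsewhere ya yb) (NP.<-trans (NP.n<1+n r) (subst (ℕ._< toℕ y) (trans (cong toℕ xb) tb) x<y′))
  by-cases (no xa) (no xb) (yes ya) _ =
    via (elsewhere xa xb) (at-a ya) (NP.<-trans (subst (toℕ x ℕ.<_) (cong toℕ ya) x<y′) (NP.n<1+n r))
  by-cases (no xa) (no xb) (no _) (yes yb) =
    via (elsewhere xa xb) (at-b yb)
        (NP.≤∧≢⇒< (NP.≤-pred (subst (toℕ x ℕ.<_) (trans (cong toℕ yb) tb) x<y′))
                  (λ e → xa (FP.toℕ-injective e)))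
  by-cases (no xa) (no xb) (no ya) (no yb) = via (elsewhere xa xb) (elsewhere ya yb) x<y′

swap-reflects : ∀ {n} (l : Letter n) {x y : Fin n} →
                swap (lo l) (hi l) x F.< swap (lo l) (hi l) y → ¬ (x ≡ hi l × y ≡ lo l) → x F.< y
swap-reflects l {x} {y} lt not-ba =
  subst₂ F._<_ (swap-involutive a b x) (swap-involutive a b y)
    (swap-monotone l lt (λ { (xa , yb) → not-ba (unswap x xa (swap-left a b) , unswap y yb (swap-right a b)) }))
  where
  a = lo l
  b = hi l
  unswap : ∀ z {c d} → swap a b z ≡ c → swap a b c ≡ d → z ≡ d
  unswap z e sc = trans (sym (swap-involutive a b z)) (trans (cong (swap a b) e) sc)

sumFin-cong : ∀ n {f g : Fin n → ℕ} → (∀ x → f x ≡ g x) → sumFin n f ≡ sumFin n g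
sumFin-cong zero e = refl
sumFin-cong (suc n) e = cong₂ _+_ (e F.zero) (sumFin-cong n (λ x → e (F.suc x)))

sumFin-zero : ∀ n (f : Fin n → ℕ) → (∀ x → f x ≡ 0) → sumFin n f ≡ 0
sumFin-zero zero f e = refl
sumFin-zero (suc n) f e rewrite e F.zero = sumFin-zero n (λ x → f (F.suc x)) (λ x → e (F.suc x))

sumFin-point : ∀ n (f g : Fin n → ℕ) (p : Fin n) (d : ℕ) → (∀ x → x ≢ p → f x ≡ g x) →
               f p ≡ d + g p → sumFin n f ≡ d + sumFin n g
sumFin-point (suc n) f g F.zero d e ep
  rewrite ep | sumFin-cong n {λ x → f (F.suc x)} {λ x → g (F.suc x)} (λ x → e (F.suc x) (λ ()))
  = NP.+-assoc d (g F.zero) _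
sumFin-point (suc n) f g (F.suc p) d e ep
  rewrite e F.zero (λ ())
        | sumFin-point n (λ x → f (F.suc x)) (λ x → g (F.suc x)) p d
                       (λ x ne → e (F.suc x) (λ s → ne (FP.suc-injective s))) ep
  = x∙yz≈y∙xz (g F.zero) d _

sumFin-swap : ∀ n (l : Letter n) (f : Fin n → ℕ) →
              sumFin n (λ x → f (swap (lo l) (hi l) x)) ≡ sumFin n f
sumFin-swap (suc (suc m)) (letter F.zero) f
  rewrite swap-left {suc (suc m)} F.zero (F.suc F.zero)
        | swap-right {suc (suc m)} F.zero (F.suc F.zero)
        | sumFin-cong m {λ x → f (swap F.zero (F.suc F.zero) (F.suc (F.suc x)))}
                        {λ x → f (F.suc (F.suc x))}
                        (λ x → cong f (swap-other F.zero (F.suc F.zero) (F.suc (F.suc x)) (λ ()) (λ ())))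
  = x∙yz≈y∙xz (f (F.suc F.zero)) (f F.zero) _
sumFin-swap (suc (suc m)) (letter (F.suc i)) f
  rewrite swap-other (F.suc (inject₁ i)) (F.suc (F.suc i)) F.zero (λ ()) (λ ())
        | sumFin-cong (suc m) {λ x → f (swap (F.suc (inject₁ i)) (F.suc (F.suc i)) (F.suc x))}
                              {λ x → f (F.suc (swap (inject₁ i) (F.suc i) x))}
                              (λ x → cong f (swap-natural F.suc FP.suc-injective (inject₁ i) (F.suc i) x))
        | sumFin-swap (suc m) (letter i) (λ x → f (F.suc x))
  = refl

inversion : ∀ {n} → Perm n → Fin n → Fin n → ℕ
inversion u x y = ind (does (x F.<? y) ∧ does (u y F.<? u x))

len-cong : ∀ {n} {u v : Perm n} → u ≗ v → len u ≡ len v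
len-cong {n} {u} {v} e = sumFin-cong n (λ x → sumFin-cong n (λ y →
  cong₂ (λ p q → ind (does (x F.<? y) ∧ does (q F.<? p))) (e x) (e y)))

len-id : ∀ {n} → len (idP {n}) ≡ 0
len-id {n} = sumFin-zero n _ (λ x → sumFin-zero n _ (λ y → no-inversion (x F.<? y) (y F.<? x)))
  where
  no-inversion : ∀ {x y : Fin n} (d : Dec (x F.< y)) (d′ : Dec (y F.< x)) → ind (does d ∧ does d′) ≡ 0
  no-inversion (yes p) (yes q) = ⊥-elim (NP.<-asym p q)
  no-inversion (yes p) (no q) = refl
  no-inversion (no p) d′ = refl

-- l is an ascent of u when u(lo l) < u(hi l), i.e. when ℓ(u s_l) > ℓ(u).
Ascent : ∀ {n} → Perm n → Letter n → Set
Ascent u l = u (lo l) F.< u (hi l)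

-- Inversions of u s_l, with both indices relabelled by s_l.
swappedInversion : ∀ {n} → Perm n → Letter n → Fin n → Fin n → ℕ
swappedInversion u l x y =
  ind (does (swap (lo l) (hi l) x F.<? swap (lo l) (hi l) y) ∧ does (u y F.<? u x))

len-swapped : ∀ {n} (u : Perm n) (l : Letter n) →
              len (u · sgen l) ≡ sumFin n (λ x → sumFin n (swappedInversion u l x))
len-swapped {n} u l =
  begin
    len (u · sgen l)
  ≡⟨ sumFin-cong n (λ x → sumFin-cong n (λ y → relabel x y)) ⟩
    sumFin n (λ x → sumFin n (λ y → swappedInversion u l (s x) (s y)))
  ≡⟨ sumFin-cong n (λ x → sumFin-swap n l (swappedInversion u l (s x))) ⟩
    sumFin n (λ x → sumFin n (swappedInversion u l (s x)))
  ≡⟨ sumFin-swap n l (λ x → sumFin n (swappedInversion u l x)) ⟩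
    sumFin n (λ x → sumFin n (swappedInversion u l x))
  ∎
  where
  open ≡-Reasoning
  s = swap (lo l) (hi l)
  relabel : ∀ x y → inversion (u · sgen l) x y ≡ swappedInversion u l (s x) (s y)
  relabel x y rewrite sgen-swap l x | sgen-swap l y
                    | swap-involutive (lo l) (hi l) x | swap-involutive (lo l) (hi l) y = refl

swappedInversion-lo-hi : ∀ {n} (u : Perm n) (l : Letter n) → Ascent u l →
                         swappedInversion u l (lo l) (hi l) ≡ inversion u (lo l) (hi l)
swappedInversion-lo-hi u l up =
  trans (ind-false (dec-false (s (lo l) F.<? s (hi l))
          (subst₂ (λ p q → ¬ (p F.< q)) (sym (swap-left (lo l) (hi l))) (sym (swap-right (lo l) (hi l)))
                  (NP.<-asym (lo<hi l)))))
        (sym (ind-false′ (dec-false (u (hi l) F.<? u (lo l)) (NP.<-asym up))))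
  where s = swap (lo l) (hi l)

swappedInversion-order : ∀ {n} (u : Perm n) (l : Letter n) x y → ¬ (x ≡ lo l × y ≡ hi l) →
                         ¬ (x ≡ hi l × y ≡ lo l) → swappedInversion u l x y ≡ inversion u x y
swappedInversion-order u l x y not-ab not-ba = cong (λ t → ind (t ∧ does (u y F.<? u x)))
  (does-↔ (swap (lo l) (hi l) x F.<? swap (lo l) (hi l) y) (x F.<? y) (λ lt → swap-reflects l lt not-ba) (λ lt → swap-monotone l lt not-ab))

swappedInversion-agrees : ∀ {n} (u : Perm n) (l : Letter n) → Ascent u l → ∀ x y →
                          ¬ (x ≡ hi l × y ≡ lo l) → swappedInversion u l x y ≡ inversion u x y
swappedInversion-agrees u l up x y not-ba = by-cases (x F.≟ lo l) (y F.≟ hi l)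
  where
  by-cases : Dec (x ≡ lo l) → Dec (y ≡ hi l) → swappedInversion u l x y ≡ inversion u x y
  by-cases (yes xa) (yes yb) = subst₂ (λ x′ y′ → swappedInversion u l x′ y′ ≡ inversion u x′ y′)
                                      (sym xa) (sym yb) (swappedInversion-lo-hi u l up)
  by-cases (yes _) (no yb) = swappedInversion-order u l x y (λ { (_ , e) → yb e }) not-ba
  by-cases (no xa) _ = swappedInversion-order u l x y (λ { (e , _) → xa e }) not-ba

swappedInversion-new : ∀ {n} (u : Perm n) (l : Letter n) → Ascent u l →
                       swappedInversion u l (hi l) (lo l) ≡ 1 + inversion u (hi l) (lo l)
swappedInversion-new u l up =
  trans (cong₂ (λ b c → ind (b ∧ c))
          (dec-true (s (hi l) F.<? s (lo l))
            (subst₂ F._<_ (sym (swap-right (lo l) (hi l))) (sym (swap-left (lo l) (hi l))) (lo<hi l)))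
          (dec-true (u (lo l) F.<? u (hi l)) up))
        (sym (cong suc (ind-false (dec-false (hi l F.<? lo l) (NP.<-asym (lo<hi l))))))
  where s = swap (lo l) (hi l)

len-ascent : ∀ {n} (u : Perm n) (l : Letter n) → Ascent u l → len (u · sgen l) ≡ suc (len u)
len-ascent {n} u l up =
  trans (len-swapped u l)
        (sumFin-point n (λ x → sumFin n (swappedInversion u l x)) (λ x → sumFin n (inversion u x)) (hi l) 1
          (λ x xb → sumFin-cong n (λ y → swappedInversion-agrees u l up x y (λ { (e , _) → xb e })))
          (sumFin-point n (swappedInversion u l (hi l)) (inversion u (hi l)) (lo l) 1
            (λ y ya → swappedInversion-agrees u l up (hi l) y (λ { (_ , e) → ya e }))
            (swappedInversion-new u l up)))

mul-sgen-twice : ∀ {n} (u : Perm n) (l : Letter n) → ((u · sgen l) · sgen l) ≗ u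
mul-sgen-twice u l x rewrite sgen-swap l x | sgen-swap l (swap (lo l) (hi l) x) =
  cong u (swap-involutive (lo l) (hi l) x)

mul-sgen-equal : ∀ {n} (u : Perm n) (l : Letter n) → u (lo l) ≡ u (hi l) → (u · sgen l) ≗ u
mul-sgen-equal u l e x rewrite sgen-swap l x = by-cases (x F.≟ lo l) (x F.≟ hi l)
  where
  by-cases : Dec (x ≡ lo l) → Dec (x ≡ hi l) → u (swap (lo l) (hi l) x) ≡ u x
  by-cases (yes xa) _ = trans (cong u (trans (cong (swap (lo l) (hi l)) xa) (swap-left (lo l) (hi l))))
                              (trans (sym e) (cong u (sym xa)))
  by-cases (no _) (yes xb) = trans (cong u (trans (cong (swap (lo l) (hi l)) xb) (swap-right (lo l) (hi l))))
                                   (trans e (cong u (sym xb)))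
  by-cases (no xa) (no xb) = cong u (swap-other (lo l) (hi l) x xa xb)

len-non-ascent : ∀ {n} (u : Perm n) (l : Letter n) → ¬ Ascent u l → len (u · sgen l) ℕ.≤ len u
len-non-ascent u l nup with NP.<-cmp (toℕ (u (lo l))) (toℕ (u (hi l)))
... | tri< p _ _ = ⊥-elim (nup p)
... | tri≈ _ e _ = NP.≤-reflexive (len-cong (mul-sgen-equal u l (FP.toℕ-injective e)))
... | tri> _ _ p = NP.<⇒≤ (subst (len (u · sgen l) ℕ.<_) len-back (NP.n<1+n _))
  where
  ascent-back : Ascent (u · sgen l) l
  ascent-back = subst₂ F._<_
    (sym (trans (cong u (sgen-swap l (lo l))) (cong u (swap-left (lo l) (hi l)))))
    (sym (trans (cong u (sgen-swap l (hi l))) (cong u (swap-right (lo l) (hi l))))) p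
  len-back : suc (len (u · sgen l)) ≡ len u
  len-back = trans (sym (len-ascent (u · sgen l) l ascent-back)) (len-cong (mul-sgen-twice u l))

len-mul-sgen : ∀ {n} (u : Perm n) (l : Letter n) → len (u · sgen l) ℕ.≤ suc (len u)
len-mul-sgen u l with u (lo l) F.<? u (hi l)
... | yes up = NP.≤-reflexive (len-ascent u l up)
... | no nup = NP.m≤n⇒m≤1+n (len-non-ascent u l nup)

≤B-len : ∀ {n} {u v : Perm n} → u ≤B v → len u ℕ.≤ len v
≤B-len (≤B-refl e) = NP.≤-reflexive (len-cong e)
≤B-len (≤B-step (_ , _ , _ , _ , lt) r) = NP.<⇒≤ (NP.<-≤-trans lt (≤B-len r))

<B-len : ∀ {n} {u v : Perm n} → u <B v → len u ℕ.< len v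
<B-len (≤B-refl e , ne) = ⊥-elim (ne e)
<B-len (≤B-step (_ , _ , _ , _ , lt) r , _) = NP.<-≤-trans lt (≤B-len r)

<B→ascent : ∀ {n} (u : Perm n) (l : Letter n) → u <B (u · sgen l) → Ascent u l
<B→ascent u l lt with u (lo l) F.<? u (hi l)
... | yes up = up
... | no nup = ⊥-elim (NP.<⇒≱ (<B-len lt) (len-non-ascent u l nup))

ascent→<B : ∀ {n} (u : Perm n) (l : Letter n) → Ascent u l → u <B (u · sgen l)
ascent→<B u l up =
  ≤B-step (lo l , hi l , lo<hi l , (λ x → cong u (sgen-swap l x)) ,
           subst (len u ℕ.<_) (sym (len-ascent u l up)) (NP.n<1+n _))
          (≤B-refl (λ x → refl)) ,
  λ e → NP.<-irrefl (cong toℕ (trans (e (lo l))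
                      (trans (cong u (sgen-swap l (lo l))) (cong u (swap-left (lo l) (hi l)))))) up

mulWord : ∀ {n} → Perm n → List (Letter n) → Perm n
mulWord u [] = u
mulWord u (l ∷ ls) = mulWord (u · sgen l) ls

mulWord-wordProd : ∀ {n} (u : Perm n) w x → mulWord u w x ≡ u (wordProd w x)
mulWord-wordProd u [] x = refl
mulWord-wordProd u (l ∷ ls) x = mulWord-wordProd (u · sgen l) ls x

AscendingWord : ∀ {n} → Perm n → List (Letter n) → Set
AscendingWord u [] = ⊤
AscendingWord u (l ∷ ls) = Ascent u l × AscendingWord (u · sgen l) ls

ascendingWord-len : ∀ {n} (u : Perm n) w → AscendingWord u w → len (mulWord u w) ≡ length w + len u
ascendingWord-len u [] _ = refl
ascendingWord-len u (l ∷ ls) (up , r) =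
  trans (ascendingWord-len (u · sgen l) ls r) (trans (cong (length ls +_) (len-ascent u l up)) (NP.+-suc _ _))

len-mulWord : ∀ {n} (u : Perm n) w → len (mulWord u w) ℕ.≤ length w + len u
len-mulWord u [] = NP.≤-refl
len-mulWord u (l ∷ ls) = NP.≤-trans (len-mulWord (u · sgen l) ls)
  (NP.≤-trans (NP.+-monoʳ-≤ (length ls) (len-mul-sgen u l)) (NP.≤-reflexive (NP.+-suc _ _)))

len→ascendingWord : ∀ {n} (u : Perm n) w → len (mulWord u w) ≡ length w + len u → AscendingWord u w
len→ascendingWord u [] e = tt
len→ascendingWord u (l ∷ ls) e with u (lo l) F.<? u (hi l)
... | yes up = up , len→ascendingWord (u · sgen l) ls
       (trans e (trans (sym (NP.+-suc _ _)) (cong (length ls +_) (sym (len-ascent u l up)))))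
... | no nup = ⊥-elim (NP.<-irrefl refl (subst (ℕ._≤ length ls + len u) e too-short))
  where
  too-short : len (mulWord (u · sgen l) ls) ℕ.≤ length ls + len u
  too-short = NP.≤-trans (len-mulWord (u · sgen l) ls) (NP.+-monoʳ-≤ (length ls) (len-non-ascent u l nup))

len-mulWord-id : ∀ {n} (w : List (Letter n)) → len (mulWord idP w) ≡ len (wordProd w)
len-mulWord-id w = len-cong (λ x → mulWord-wordProd idP w x)

length-plus-len-id : ∀ {n} (w : List (Letter n)) → length w + len (idP {n}) ≡ length w
length-plus-len-id {n} w = trans (cong (length w +_) (len-id {n})) (NP.+-identityʳ _)

reduced→ascending : ∀ {n} (w : List (Letter n)) → IsReduced w → AscendingWord (idP {n}) w
reduced→ascending w red =
  len→ascendingWord idP w (trans (len-mulWord-id w) (trans red (sym (length-plus-len-id w))))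

ascending→reduced : ∀ {n} (w : List (Letter n)) → AscendingWord (idP {n}) w → IsReduced w
ascending→reduced w asc =
  trans (sym (len-mulWord-id w)) (trans (ascendingWord-len idP w asc) (length-plus-len-id w))

AscendingDiagram : ∀ {n} → Perm n → Diagram n → Set
AscendingDiagram u [] = ⊤
AscendingDiagram u ((l , b) ∷ ls) = Ascent u l × AscendingDiagram (nextU u (l , b)) ls

PDS→ascending : ∀ {n} (u : Perm n) D → PDSfrom u D → AscendingDiagram u D
PDS→ascending u [] _ = tt
PDS→ascending u ((l , b) ∷ ls) (_ , lt , r) = <B→ascent u l lt , PDS→ascending (nextU u (l , b)) ls r

ascending→PDS : ∀ {n} (u : Perm n) D → AscendingDiagram u D → PDSfrom u D
ascending→PDS u [] _ = tt
ascending→PDS u ((l , true) ∷ ls) (up , r) =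
  ≤B-refl (λ x → refl) , ascent→<B u l up , ascending→PDS (u · sgen l) ls r
ascending→PDS u ((l , false) ∷ ls) (up , r) =
  proj₁ (ascent→<B u l up) , ascent→<B u l up , ascending→PDS u ls r

≗-sym : ∀ {n} {u v : Perm n} → u ≗ v → v ≗ u
≗-sym e x = sym (e x)

ascent-cong : ∀ {n} {u v : Perm n} (l : Letter n) → u ≗ v → Ascent u l → Ascent v l
ascent-cong l e up = subst₂ F._<_ (e (lo l)) (e (hi l)) up

ascendingWord-cong : ∀ {n} {u v : Perm n} w → u ≗ v → AscendingWord u w → AscendingWord v w
ascendingWord-cong [] e _ = tt
ascendingWord-cong (l ∷ ls) e (up , r) = ascent-cong l e up , ascendingWord-cong ls (λ x → e (sgen l x)) r

ascendingDiagram-cong : ∀ {n} {u v : Perm n} D → u ≗ v → AscendingDiagram u D → AscendingDiagram v D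
ascendingDiagram-cong [] e _ = tt
ascendingDiagram-cong ((l , true) ∷ ls) e (up , r) =
  ascent-cong l e up , ascendingDiagram-cong ls (λ x → e (sgen l x)) r
ascendingDiagram-cong ((l , false) ∷ ls) e (up , r) = ascent-cong l e up , ascendingDiagram-cong ls e r

mulWord-cong : ∀ {n} {u v : Perm n} w → u ≗ v → mulWord u w ≗ mulWord v w
mulWord-cong {u = u} {v} w e x = trans (mulWord-wordProd u w x) (trans (e _) (sym (mulWord-wordProd v w x)))

finalU-cong : ∀ {n} {u v : Perm n} D → u ≗ v → finalU u D ≗ finalU v D
finalU-cong [] e = e
finalU-cong ((l , true) ∷ ls) e = finalU-cong ls (λ x → e (sgen l x))
finalU-cong ((l , false) ∷ ls) e = finalU-cong ls e

orderedPair : ∀ {n} → Fin n → Fin n → Bridge n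
orderedPair a b = if does (a F.<? b) then (a , b) else (b , a)

conjPair-orderedPair : ∀ {n} (u : Perm n) l → conjPair u l ≡ orderedPair (u (lo l)) (u (hi l))
conjPair-orderedPair {suc m} u (letter i) = refl

bridgesFrom-cong : ∀ {n} {u v : Perm n} D → u ≗ v → bridgesFrom u D ≡ bridgesFrom v D
bridgesFrom-cong [] e = refl
bridgesFrom-cong ((l , true) ∷ ls) e = bridgesFrom-cong ls (λ x → e (sgen l x))
bridgesFrom-cong {u = u} {v} ((l , false) ∷ ls) e =
  cong₂ _∷_ (trans (conjPair-orderedPair u l)
              (trans (cong₂ orderedPair (e (lo l)) (e (hi l))) (sym (conjPair-orderedPair v l))))
            (bridgesFrom-cong ls e)

finalU-++ : ∀ {n} (u : Perm n) xs ys → finalU u (xs ++ ys) ≡ finalU (finalU u xs) ys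
finalU-++ u [] ys = refl
finalU-++ u (l ∷ xs) ys = finalU-++ (nextU u l) xs ys

bridgesFrom-++ : ∀ {n} (u : Perm n) xs ys →
                 bridgesFrom u (xs ++ ys) ≡ bridgesFrom u xs ++ bridgesFrom (finalU u xs) ys
bridgesFrom-++ u [] ys = refl
bridgesFrom-++ u ((l , true) ∷ xs) ys = bridgesFrom-++ (u · sgen l) xs ys
bridgesFrom-++ u ((l , false) ∷ xs) ys = cong (conjPair u l ∷_) (bridgesFrom-++ u xs ys)

ascendingWord-++ : ∀ {n} (u : Perm n) xs ys → AscendingWord u xs → AscendingWord (mulWord u xs) ys →
                   AscendingWord u (xs ++ ys)
ascendingWord-++ u [] ys _ r = r
ascendingWord-++ u (l ∷ xs) ys (up , a) r = up , ascendingWord-++ (u · sgen l) xs ys a r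

ascendingDiagram-++ : ∀ {n} (u : Perm n) xs ys → AscendingDiagram u xs →
                      AscendingDiagram (finalU u xs) ys → AscendingDiagram u (xs ++ ys)
ascendingDiagram-++ u [] ys _ r = r
ascendingDiagram-++ u (l ∷ xs) ys (up , a) r = up , ascendingDiagram-++ (nextU u l) xs ys a r

allInJ : ∀ {n} → List (Letter n) → Diagram n
allInJ = map (λ l → (l , true))

word-allInJ : ∀ {n} (w : List (Letter n)) → word (allInJ w) ≡ w
word-allInJ [] = refl
word-allInJ (l ∷ w) = cong (l ∷_) (word-allInJ w)

finalU-allInJ : ∀ {n} (u : Perm n) w → finalU u (allInJ w) ≡ mulWord u w
finalU-allInJ u [] = refl
finalU-allInJ u (l ∷ w) = finalU-allInJ (u · sgen l) w

ascendingDiagram-allInJ : ∀ {n} (u : Perm n) w → AscendingWord u w → AscendingDiagram u (allInJ w)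
ascendingDiagram-allInJ u [] _ = tt
ascendingDiagram-allInJ u (l ∷ w) (up , r) = up , ascendingDiagram-allInJ (u · sgen l) w r

bridgesFrom-allInJ : ∀ {n} (u : Perm n) w → bridgesFrom u (allInJ w) ≡ []
bridgesFrom-allInJ u [] = refl
bridgesFrom-allInJ u (l ∷ w) = bridgesFrom-allInJ (u · sgen l) w

punchIn-below : ∀ {n} (i : Fin (suc n)) (j : Fin n) → toℕ j ℕ.< toℕ i → toℕ (punchIn i j) ≡ toℕ j
punchIn-below (F.suc i) F.zero p = refl
punchIn-below (F.suc i) (F.suc j) (s≤s p) = cong suc (punchIn-below i j p)

punchIn-above : ∀ {n} (i : Fin (suc n)) (j : Fin n) → toℕ i ℕ.≤ toℕ j → toℕ (punchIn i j) ≡ suc (toℕ j)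
punchIn-above F.zero j p = refl
punchIn-above (F.suc i) (F.suc j) (s≤s p) = cong suc (punchIn-above i j p)

punchIn-cases : ∀ {n} (i : Fin (suc n)) (j : Fin n) →
  (toℕ j ℕ.< toℕ i × toℕ (punchIn i j) ≡ toℕ j) ⊎ (toℕ i ℕ.≤ toℕ j × toℕ (punchIn i j) ≡ suc (toℕ j))
punchIn-cases i j with toℕ j ℕ.<? toℕ i
... | yes p = inj₁ (p , punchIn-below i j p)
... | no p = inj₂ (NP.≮⇒≥ p , punchIn-above i j (NP.≮⇒≥ p))

punchIn-≥ : ∀ {n} (i : Fin (suc n)) (j : Fin n) → toℕ j ℕ.≤ toℕ (punchIn i j)
punchIn-≥ i j with punchIn-cases i j
... | inj₁ (_ , t) = NP.≤-reflexive (sym t)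
... | inj₂ (_ , t) = subst (toℕ j ℕ.≤_) (sym t) (NP.n≤1+n _)

punchIn-≤suc : ∀ {n} (i : Fin (suc n)) (j : Fin n) → toℕ (punchIn i j) ℕ.≤ suc (toℕ j)
punchIn-≤suc i j with punchIn-cases i j
... | inj₁ (_ , t) = subst (ℕ._≤ suc (toℕ j)) (sym t) (NP.n≤1+n _)
... | inj₂ (_ , t) = NP.≤-reflexive t

punchIn-mono : ∀ {n} (i : Fin (suc n)) (j k : Fin n) → j F.< k → punchIn i j F.< punchIn i k
punchIn-mono i j k j<k = NP.≤∧≢⇒< (FP.punchIn-mono-≤ i j k (NP.<⇒≤ j<k))
  (λ e → FP.<⇒≢ j<k (FP.punchIn-injective i j k (FP.toℕ-injective e)))

punchIn-reflects : ∀ {n} (i : Fin (suc n)) (j k : Fin n) → punchIn i j F.< punchIn i k → j F.< k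
punchIn-reflects i j k lt = NP.≰⇒> (λ k≤j → NP.<⇒≱ lt (FP.punchIn-mono-≤ i k j k≤j))

punchIn-last : ∀ {n} (x : Fin n) → punchIn (fromℕ n) x ≡ inject₁ x
punchIn-last {suc n} F.zero = refl
punchIn-last {suc n} (F.suc x) = cong F.suc (punchIn-last x)

q<punchIn : ∀ {n} (q : Fin (suc n)) (c : Fin n) → toℕ q ℕ.≤ toℕ c → q F.< punchIn q c
q<punchIn q c p = subst (toℕ q ℕ.<_) (sym (punchIn-above q c p)) (s≤s p)

punchIn<q : ∀ {n} (q : Fin (suc n)) (c : Fin n) → toℕ c ℕ.< toℕ q → punchIn q c F.< q
punchIn<q q c p = subst (ℕ._< toℕ q) (sym (punchIn-below q c p)) p

punchIn-view : ∀ {n} (p x : Fin (suc n)) → x ≡ p ⊎ Σ (Fin n) (λ x′ → x ≡ punchIn p x′)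
punchIn-view p x with p F.≟ x
... | yes e = inj₁ (sym e)
... | no ne = inj₂ (punchOut ne , sym (FP.punchIn-punchOut ne))

graft : ∀ {n} → Fin (suc n) → Fin (suc n) → Perm n → Perm (suc n)
graft p q v x with p F.≟ x
... | yes _ = q
... | no ne = punchIn q (v (punchOut ne))

graft-at : ∀ {n} (p q : Fin (suc n)) (v : Perm n) → graft p q v p ≡ q
graft-at p q v with p F.≟ p
... | yes _ = refl
... | no ne = ⊥-elim (ne refl)

graft-punchIn : ∀ {n} (p q : Fin (suc n)) (v : Perm n) y → graft p q v (punchIn p y) ≡ punchIn q (v y)
graft-punchIn p q v y with p F.≟ punchIn p y
... | yes e = ⊥-elim (FP.punchInᵢ≢i p y (sym e))
... | no ne = cong (λ z → punchIn q (v z))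
                (trans (FP.punchOut-cong p {i≢j = ne} {i≢k = λ e → FP.punchInᵢ≢i p y (sym e)} refl)
                       (FP.punchOut-punchIn p))

graft-unique : ∀ {n} (p q : Fin (suc n)) (v : Perm n) (f : Perm (suc n)) →
               f p ≡ q → (∀ y → f (punchIn p y) ≡ punchIn q (v y)) → f ≗ graft p q v
graft-unique p q v f fp fy x with p F.≟ x
... | yes refl = fp
... | no ne = trans (cong f (sym (FP.punchIn-punchOut ne))) (fy (punchOut ne))

id-graft : ∀ {n} (q : Fin (suc n)) → idP ≗ graft q q idP
id-graft q = graft-unique q q idP idP refl (λ y → refl)

ascent-graft : ∀ {n} (p q : Fin (suc n)) (v : Perm n) (l : Letter n) (l′ : Letter (suc n)) →
               lo l′ ≡ punchIn p (lo l) → hi l′ ≡ punchIn p (hi l) → Ascent v l → Ascent (graft p q v) l′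
ascent-graft p q v l l′ elo ehi up rewrite elo | ehi | graft-punchIn p q v (lo l) | graft-punchIn p q v (hi l) =
  punchIn-mono q _ _ up

orderedPair-punchIn : ∀ {n} (q : Fin (suc n)) (a b : Fin n) →
  orderedPair (punchIn q a) (punchIn q b) ≡ (punchIn q (proj₁ (orderedPair a b)) , punchIn q (proj₂ (orderedPair a b)))
orderedPair-punchIn q a b
  rewrite does-↔ (punchIn q a F.<? punchIn q b) (a F.<? b) (punchIn-reflects q a b) (punchIn-mono q a b)
  with does (a F.<? b)
... | true = refl
... | false = refl

-- A relabelling of letters along punchIn p.  Adjacent positions stay
-- adjacent under punchIn p only for p = 0 and p = n, which are exactly the
-- two positions used below.
record LetterLift (n : ℕ) (p : Fin (suc n)) : Set where
  field
    liftL : Letter n → Letter (suc n)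
    lo-lift : ∀ l → lo (liftL l) ≡ punchIn p (lo l)
    hi-lift : ∀ l → hi (liftL l) ≡ punchIn p (hi l)

shiftLetter : ∀ {n} → Letter n → Letter (suc n)
shiftLetter {suc m} (letter i) = letter (F.suc i)

liftFirst : ∀ {n} → LetterLift n F.zero
liftFirst = record { liftL = shiftLetter ; lo-lift = lo-shift ; hi-lift = hi-shift }
  where
  lo-shift : ∀ {n} (l : Letter n) → lo (shiftLetter l) ≡ punchIn F.zero (lo l)
  lo-shift {suc m} (letter i) = refl
  hi-shift : ∀ {n} (l : Letter n) → hi (shiftLetter l) ≡ punchIn F.zero (hi l)
  hi-shift {suc m} (letter i) = refl

keepLetter : ∀ {n} → Letter n → Letter (suc n)
keepLetter {suc m} (letter i) = letter (inject₁ i)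

liftLast : ∀ {n} → LetterLift n (fromℕ n)
liftLast = record { liftL = keepLetter ; lo-lift = lo-keep ; hi-lift = hi-keep }
  where
  lo-keep : ∀ {n} (l : Letter n) → lo (keepLetter l) ≡ punchIn (fromℕ n) (lo l)
  lo-keep {suc m} (letter i) = sym (punchIn-last (inject₁ i))
  hi-keep : ∀ {n} (l : Letter n) → hi (keepLetter l) ≡ punchIn (fromℕ n) (hi l)
  hi-keep {suc m} (letter i) = sym (punchIn-last (F.suc i))

module GraftedDiagram {n} {p : Fin (suc n)} (lift : LetterLift n p) (q : Fin (suc n)) where
  open LetterLift lift

  graft-sgen : ∀ (v : Perm n) l → (graft p q v · sgen (liftL l)) ≗ graft p q (v · sgen l)
  graft-sgen v l = graft-unique p q (v · sgen l) (graft p q v · sgen (liftL l)) fixes-p moves-rest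
    where
    fixes-p : graft p q v (sgen (liftL l) p) ≡ q
    fixes-p = trans (cong (graft p q v) (trans (sgen-swap (liftL l) p)
                (swap-other _ _ p (λ e → FP.punchInᵢ≢i p (lo l) (trans (sym (lo-lift l)) (sym e)))
                                  (λ e → FP.punchInᵢ≢i p (hi l) (trans (sym (hi-lift l)) (sym e))))))
                    (graft-at p q v)
    moves-rest : ∀ y → graft p q v (sgen (liftL l) (punchIn p y)) ≡ punchIn q (v (sgen l y))
    moves-rest y rewrite sgen-swap (liftL l) (punchIn p y) | lo-lift l | hi-lift l | sgen-swap l y
      | swap-natural (punchIn p) (λ {x} {y} → FP.punchIn-injective p x y) (lo l) (hi l) y
      = graft-punchIn p q v _

  liftEntry : Letter n × Bool → Letter (suc n) × Bool
  liftEntry (l , b) = (liftL l , b)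

  liftDiagram : Diagram n → Diagram (suc n)
  liftDiagram = map liftEntry

  ascent-lift : ∀ (v : Perm n) l → Ascent v l → Ascent (graft p q v) (liftL l)
  ascent-lift v l = ascent-graft p q v l (liftL l) (lo-lift l) (hi-lift l)

  mulWord-lift : ∀ (v : Perm n) w → mulWord (graft p q v) (map liftL w) ≗ graft p q (mulWord v w)
  mulWord-lift v [] x = refl
  mulWord-lift v (l ∷ w) x = trans (mulWord-cong (map liftL w) (graft-sgen v l) x) (mulWord-lift (v · sgen l) w x)

  ascendingWord-lift : ∀ (v : Perm n) w → AscendingWord v w → AscendingWord (graft p q v) (map liftL w)
  ascendingWord-lift v [] _ = tt
  ascendingWord-lift v (l ∷ w) (up , r) =
    ascent-lift v l up , ascendingWord-cong (map liftL w) (≗-sym (graft-sgen v l)) (ascendingWord-lift (v · sgen l) w r)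

  finalU-lift : ∀ (v : Perm n) D → finalU (graft p q v) (liftDiagram D) ≗ graft p q (finalU v D)
  finalU-lift v [] x = refl
  finalU-lift v ((l , true) ∷ D) x = trans (finalU-cong (liftDiagram D) (graft-sgen v l) x) (finalU-lift (v · sgen l) D x)
  finalU-lift v ((l , false) ∷ D) x = finalU-lift v D x

  ascendingDiagram-lift : ∀ (v : Perm n) D → AscendingDiagram v D → AscendingDiagram (graft p q v) (liftDiagram D)
  ascendingDiagram-lift v [] _ = tt
  ascendingDiagram-lift v ((l , true) ∷ D) (up , r) =
    ascent-lift v l up ,
    ascendingDiagram-cong (liftDiagram D) (≗-sym (graft-sgen v l)) (ascendingDiagram-lift (v · sgen l) D r)
  ascendingDiagram-lift v ((l , false) ∷ D) (up , r) = ascent-lift v l up , ascendingDiagram-lift v D r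

  conjPair-lift : ∀ (v : Perm n) l → conjPair (graft p q v) (liftL l) ≡
                  (punchIn q (proj₁ (conjPair v l)) , punchIn q (proj₂ (conjPair v l)))
  conjPair-lift v l =
    begin
      conjPair (graft p q v) (liftL l)
    ≡⟨ conjPair-orderedPair (graft p q v) (liftL l) ⟩
      orderedPair (graft p q v (lo (liftL l))) (graft p q v (hi (liftL l)))
    ≡⟨ cong₂ orderedPair (trans (cong (graft p q v) (lo-lift l)) (graft-punchIn p q v (lo l)))
                         (trans (cong (graft p q v) (hi-lift l)) (graft-punchIn p q v (hi l))) ⟩
      orderedPair (punchIn q (v (lo l))) (punchIn q (v (hi l)))
    ≡⟨ orderedPair-punchIn q (v (lo l)) (v (hi l)) ⟩
      (punchIn q (proj₁ (orderedPair (v (lo l)) (v (hi l)))) , punchIn q (proj₂ (orderedPair (v (lo l)) (v (hi l)))))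
    ≡⟨ cong (λ z → (punchIn q (proj₁ z) , punchIn q (proj₂ z))) (sym (conjPair-orderedPair v l)) ⟩
      (punchIn q (proj₁ (conjPair v l)) , punchIn q (proj₂ (conjPair v l)))
    ∎
    where open ≡-Reasoning

  bridgesFrom-lift : ∀ (v : Perm n) D → bridgesFrom (graft p q v) (liftDiagram D) ≡ shiftBridges q (bridgesFrom v D)
  bridgesFrom-lift v [] = refl
  bridgesFrom-lift v ((l , true) ∷ D) =
    trans (bridgesFrom-cong (liftDiagram D) (graft-sgen v l)) (bridgesFrom-lift (v · sgen l) D)
  bridgesFrom-lift v ((l , false) ∷ D) = cong₂ _∷_ (conjPair-lift v l) (bridgesFrom-lift v D)

  word-lift : ∀ (D : Diagram n) → word (liftDiagram D) ≡ map liftL (word D)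
  word-lift [] = refl
  word-lift ((l , b) ∷ D) = cong (liftL l ∷_) (word-lift D)

letterAt : ∀ {n} (r : ℕ) → r ℕ.< n → Letter (suc n)
letterAt r h = letter (fromℕ< h)

lo-letterAt : ∀ {n} r (h : r ℕ.< n) → toℕ (lo (letterAt r h)) ≡ r
lo-letterAt r h = trans (FP.toℕ-inject₁ (fromℕ< h)) (FP.toℕ-fromℕ< h)

hi-letterAt : ∀ {n} r (h : r ℕ.< n) → toℕ (hi (letterAt r h)) ≡ suc r
hi-letterAt r h = cong suc (FP.toℕ-fromℕ< h)

suc≡punchIn-inject₁ : ∀ {n} (i : Fin n) → F.suc i ≡ punchIn (inject₁ i) i
suc≡punchIn-inject₁ i = FP.toℕ-injective (sym (punchIn-above (inject₁ i) i (NP.≤-reflexive (FP.toℕ-inject₁ i))))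

inject₁≡punchIn-suc : ∀ {n} (i : Fin n) → inject₁ i ≡ punchIn (F.suc i) i
inject₁≡punchIn-suc i = FP.toℕ-injective (trans (FP.toℕ-inject₁ i) (sym (punchIn-below (F.suc i) i (NP.n<1+n _))))

swap-punchIn : ∀ {n} (a b : Fin (suc n)) → toℕ b ≡ suc (toℕ a) → ∀ y → swap a b (punchIn b y) ≡ punchIn a y
swap-punchIn a b tb y with NP.<-cmp (toℕ y) (toℕ a)
... | tri< ya _ _ =
  trans (swap-other a b _ (λ e → NP.<-irrefl (trans (sym below-b) (cong toℕ e)) ya)
                          (λ e → NP.<-irrefl (trans (sym below-b) (cong toℕ e)) y<b))
        (FP.toℕ-injective (trans below-b (sym (punchIn-below a y ya))))
  where
  y<b : toℕ y ℕ.< toℕ b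
  y<b = NP.<-trans ya (subst (toℕ a ℕ.<_) (sym tb) (NP.n<1+n _))
  below-b : toℕ (punchIn b y) ≡ toℕ y
  below-b = punchIn-below b y y<b
... | tri≈ _ ya _ =
  trans (cong (swap a b) (FP.toℕ-injective (trans (punchIn-below b y (subst (toℕ y ℕ.<_) (sym tb) (s≤s (NP.≤-reflexive ya)))) ya)))
        (trans (swap-left a b)
               (FP.toℕ-injective (trans tb (trans (cong suc (sym ya)) (sym (punchIn-above a y (NP.≤-reflexive (sym ya))))))))
... | tri> _ _ ay =
  trans (swap-other a b _ (λ e → NP.<-irrefl (sym (trans (sym above-b) (cong toℕ e))) (NP.<-trans ay (NP.n<1+n _)))
                          (λ e → NP.<-irrefl (sym (trans (sym above-b) (cong toℕ e))) (s≤s b≤y)))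
        (FP.toℕ-injective (trans above-b (sym (punchIn-above a y (NP.<⇒≤ ay)))))
  where
  b≤y : toℕ b ℕ.≤ toℕ y
  b≤y = subst (ℕ._≤ toℕ y) (sym tb) ay
  above-b : toℕ (punchIn b y) ≡ suc (toℕ y)
  above-b = punchIn-above b y b≤y

graft-step-up : ∀ {n} (a b q : Fin (suc n)) (v : Perm n) → toℕ b ≡ suc (toℕ a) →
                (graft a q v · swap a b) ≗ graft b q v
graft-step-up a b q v tb = graft-unique b q v (graft a q v · swap a b)
  (trans (cong (graft a q v) (swap-right a b)) (graft-at a q v))
  (λ y → trans (cong (graft a q v) (swap-punchIn a b tb y)) (graft-punchIn a q v y))

graft-step-down : ∀ {n} (a b q : Fin (suc n)) (v : Perm n) → toℕ b ≡ suc (toℕ a) →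
                  (graft b q v · swap a b) ≗ graft a q v
graft-step-down a b q v tb x =
  trans (sym (graft-step-up a b q v tb (swap a b x))) (cong (graft a q v) (swap-involutive a b x))

slideUp : ∀ {n} (r t : ℕ) → r + t ℕ.≤ n → List (Letter (suc n))
slideUp r zero h = []
slideUp {n} r (suc t) h =
  letterAt r (NP.<-≤-trans (NP.m<m+n r (s≤s z≤n)) h) ∷ slideUp (suc r) t (subst (ℕ._≤ n) (NP.+-suc r t) h)

slideDown : ∀ {n} (r t : ℕ) → r + t ℕ.≤ n → List (Letter (suc n))
slideDown r zero h = []
slideDown {n} r (suc t) h =
  letterAt (r + t) (subst (ℕ._≤ n) (NP.+-suc r t) h) ∷
  slideDown r t (NP.≤-trans (NP.n≤1+n (r + t)) (subst (ℕ._≤ n) (NP.+-suc r t) h))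

Slides : ∀ {n} → Perm (suc n) → List (Letter (suc n)) → Perm (suc n) → Set
Slides u w u′ = AscendingWord u w × (mulWord u w ≗ u′)

slides-cong : ∀ {n} {u v u′ : Perm (suc n)} w → u ≗ v → Slides u w u′ → Slides v w u′
slides-cong w e (asc , ends) = ascendingWord-cong w e asc , (λ x → trans (sym (mulWord-cong w e x)) (ends x))

slideUp-graft : ∀ {n} t r (h : r + t ℕ.≤ n) (v : Perm n) (q a : Fin (suc n)) → toℕ a ≡ r →
  (∀ y → r ℕ.≤ toℕ y → toℕ y ℕ.< r + t → toℕ q ℕ.≤ toℕ (v y)) →
  (b : Fin (suc n)) → toℕ b ≡ r + t → Slides (graft a q v) (slideUp r t h) (graft b q v)
slideUp-graft zero r h v q a ta passed b tb =
  tt , (λ x → cong (λ z → graft z q v x) (FP.toℕ-injective (trans ta (sym (trans tb (NP.+-identityʳ r))))))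
slideUp-graft {n} (suc t) r h v q a ta passed b tb =
  (ascent , proj₁ rest) , proj₂ rest
  where
  hl : r ℕ.< n
  hl = NP.<-≤-trans (NP.m<m+n r (s≤s z≤n)) h
  h′ : suc r + t ℕ.≤ n
  h′ = subst (ℕ._≤ n) (NP.+-suc r t) h
  l = letterAt r hl
  i = fromℕ< hl
  lo-a : lo l ≡ a
  lo-a = FP.toℕ-injective (trans (lo-letterAt r hl) (sym ta))
  ascent : Ascent (graft a q v) l
  ascent = subst₂ F._<_ (sym (trans (cong (graft a q v) lo-a) (graft-at a q v)))
    (sym (trans (cong (graft a q v) (trans (suc≡punchIn-inject₁ i) (cong (λ z → punchIn z i) lo-a)))
                (graft-punchIn a q v i)))
    (q<punchIn q (v i) (passed i (NP.≤-reflexive (sym (FP.toℕ-fromℕ< hl)))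
                         (subst (ℕ._< r + suc t) (sym (FP.toℕ-fromℕ< hl)) (NP.m<m+n r (s≤s z≤n)))))
  step : (graft a q v · sgen l) ≗ graft (hi l) q v
  step x = trans (cong (graft a q v) (trans (sgen-swap l x) (cong (λ z → swap z (hi l) x) lo-a)))
                 (graft-step-up a (hi l) q v (trans (hi-letterAt r hl) (cong suc (sym ta))) x)
  rest = slides-cong (slideUp (suc r) t h′) (≗-sym step)
           (slideUp-graft t (suc r) h′ v q (hi l) (hi-letterAt r hl)
              (λ y ry yr → passed y (NP.<⇒≤ ry) (subst (toℕ y ℕ.<_) (sym (NP.+-suc r t)) yr))
              b (trans tb (NP.+-suc r t)))

slideDown-graft : ∀ {n} t r (h : r + t ℕ.≤ n) (v : Perm n) (q a : Fin (suc n)) → toℕ a ≡ r + t →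
  (∀ y → r ℕ.≤ toℕ y → toℕ y ℕ.< r + t → toℕ (v y) ℕ.< toℕ q) →
  (b : Fin (suc n)) → toℕ b ≡ r → Slides (graft a q v) (slideDown r t h) (graft b q v)
slideDown-graft zero r h v q a ta passed b tb =
  tt , (λ x → cong (λ z → graft z q v x) (FP.toℕ-injective (trans ta (trans (NP.+-identityʳ r) (sym tb)))))
slideDown-graft {n} (suc t) r h v q a ta passed b tb =
  (ascent , proj₁ rest) , proj₂ rest
  where
  hl : r + t ℕ.< n
  hl = subst (ℕ._≤ n) (NP.+-suc r t) h
  h′ : r + t ℕ.≤ n
  h′ = NP.≤-trans (NP.n≤1+n (r + t)) hl
  l = letterAt (r + t) hl
  i = fromℕ< hl
  hi-a : hi l ≡ a
  hi-a = FP.toℕ-injective (trans (hi-letterAt (r + t) hl) (sym (trans ta (NP.+-suc r t))))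
  ascent : Ascent (graft a q v) l
  ascent = subst₂ F._<_
    (sym (trans (cong (graft a q v) (trans (inject₁≡punchIn-suc i) (cong (λ z → punchIn z i) hi-a)))
                (graft-punchIn a q v i)))
    (sym (trans (cong (graft a q v) hi-a) (graft-at a q v)))
    (punchIn<q q (v i) (passed i (subst (r ℕ.≤_) (sym (FP.toℕ-fromℕ< hl)) (NP.m≤m+n r t))
                         (subst (ℕ._< r + suc t) (sym (FP.toℕ-fromℕ< hl))
                                (subst (r + t ℕ.<_) (sym (NP.+-suc r t)) (NP.n<1+n _)))))
  step : (graft a q v · sgen l) ≗ graft (lo l) q v
  step x = trans (cong (graft a q v) (trans (sgen-swap l x) (cong (λ z → swap (lo l) z x) hi-a)))
    (graft-step-down (lo l) a q v
      (trans (sym (cong toℕ hi-a)) (trans (hi-letterAt (r + t) hl) (cong suc (sym (lo-letterAt (r + t) hl))))) x)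
  rest = slides-cong (slideDown r t h′) (≗-sym step)
           (slideDown-graft t r h′ v q (lo l) (lo-letterAt (r + t) hl)
              (λ y ry yr → passed y ry (NP.<-trans yr (subst (r + t ℕ.<_) (sym (NP.+-suc r t)) (NP.n<1+n _))))
              b tb)

highBefore : ∀ {n} → Perm n → ℕ → ℕ → ℕ
highBefore {n} v i j = sumFin n (λ y → ind (does (toℕ y ℕ.<? i) ∧ does (j ℕ.≤? toℕ (v y))))

lowFrom : ∀ {n} → Perm n → ℕ → ℕ → ℕ
lowFrom {n} v i j = sumFin n (λ y → ind (does (i ℕ.≤? toℕ y) ∧ does (toℕ (v y) ℕ.<? j)))

-- u is dominated by w when all these counts of u are bounded by those of w
-- (the counting criterion for u ≤ w in Bruhat order; we only need, and
-- prove, that it holds along a PDS).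
Dominated : ∀ {n} → Perm n → Perm n → Set
Dominated u w = ∀ i j → highBefore u i j ℕ.≤ highBefore w i j × lowFrom u i j ℕ.≤ lowFrom w i j

sum-sgen-invariant : ∀ {n} (l : Letter n) (P : ℕ → Bool) (h : Bool → Fin n → ℕ) (v : Perm n) →
  P (toℕ (lo l)) ≡ P (toℕ (hi l)) →
  sumFin n (λ y → h (P (toℕ y)) (v (sgen l y))) ≡ sumFin n (λ y → h (P (toℕ y)) (v y))
sum-sgen-invariant {n} l P h v same =
  trans (sumFin-cong n (λ y → cong₂ (λ a b → h (P (toℕ a)) (v b)) (sym (swap-involutive (lo l) (hi l) y)) (sgen-swap l y)))
  (trans (sumFin-swap n l (λ y → h (P (toℕ (s y))) (v y))) (sumFin-cong n (λ y → cong (λ b → h b (v y)) (P-swap y))))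
  where
  s = swap (lo l) (hi l)
  P-swap : ∀ y → P (toℕ (s y)) ≡ P (toℕ y)
  P-swap y = by-cases (y F.≟ lo l) (y F.≟ hi l)
    where
    by-cases : Dec (y ≡ lo l) → Dec (y ≡ hi l) → P (toℕ (s y)) ≡ P (toℕ y)
    by-cases (yes e) _ = trans (cong (λ z → P (toℕ z)) (trans (cong s e) (swap-left (lo l) (hi l))))
                               (trans (sym same) (cong (λ z → P (toℕ z)) (sym e)))
    by-cases (no _) (yes e) = trans (cong (λ z → P (toℕ z)) (trans (cong s e) (swap-right (lo l) (hi l))))
                                    (trans same (cong (λ z → P (toℕ z)) (sym e)))
    by-cases (no a) (no b) = cong (λ z → P (toℕ z)) (swap-other (lo l) (hi l) y a b)

highBefore-sgen : ∀ {n} (v : Perm n) l i j → i ≢ suc (toℕ (lo l)) → highBefore (v · sgen l) i j ≡ highBefore v i j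
highBefore-sgen v l i j ne =
  sum-sgen-invariant l (λ m → does (m ℕ.<? i)) (λ b c → ind (b ∧ does (j ℕ.≤? toℕ c))) v
    (does-↔ (toℕ (lo l) ℕ.<? i) (toℕ (hi l) ℕ.<? i)
       (λ p → subst (ℕ._< i) (sym (toℕ-hi l)) (NP.≤∧≢⇒< p (λ e → ne (sym e))))
       (λ p → NP.<-trans (NP.n<1+n _) (subst (ℕ._< i) (toℕ-hi l) p)))

lowFrom-sgen : ∀ {n} (v : Perm n) l i j → i ≢ suc (toℕ (lo l)) → lowFrom (v · sgen l) i j ≡ lowFrom v i j
lowFrom-sgen v l i j ne =
  sum-sgen-invariant l (λ m → does (i ℕ.≤? m)) (λ b c → ind (b ∧ does (toℕ c ℕ.<? j))) v
    (does-↔ (i ℕ.≤? toℕ (lo l)) (i ℕ.≤? toℕ (hi l))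
       (λ p → subst (i ℕ.≤_) (sym (toℕ-hi l)) (NP.m≤n⇒m≤1+n p))
       (λ p → NP.≤-pred (NP.≤∧≢⇒< (subst (i ℕ.≤_) (toℕ-hi l) p) ne)))

highBefore-suc : ∀ {n} (v : Perm n) (y : Fin n) i j → toℕ y ≡ i →
  highBefore v (suc i) j ≡ ind (does (j ℕ.≤? toℕ (v y))) + highBefore v i j
highBefore-suc {n} v y i j ty = sumFin-point n _ _ y _
  (λ z ne → cong (λ b → ind (b ∧ does (j ℕ.≤? toℕ (v z))))
    (does-↔ (toℕ z ℕ.<? suc i) (toℕ z ℕ.<? i)
       (λ p → NP.≤∧≢⇒< (NP.≤-pred p) (λ e → ne (FP.toℕ-injective (trans e (sym ty)))))
       (λ p → NP.<-trans p (NP.n<1+n _))))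
  (trans (ind-true _ (dec-true (toℕ y ℕ.<? suc i) (subst (ℕ._< suc i) (sym ty) (NP.n<1+n _))))
         (sym (trans (cong (ind (does (j ℕ.≤? toℕ (v y))) +_)
                           (ind-false (dec-false (toℕ y ℕ.<? i) (λ p → NP.<-irrefl ty p))))
                     (NP.+-identityʳ _))))

lowFrom-pred : ∀ {n} (v : Perm n) (y : Fin n) i j → toℕ y ≡ i →
  lowFrom v i j ≡ ind (does (toℕ (v y) ℕ.<? j)) + lowFrom v (suc i) j
lowFrom-pred {n} v y i j ty = sumFin-point n _ _ y _
  (λ z ne → cong (λ b → ind (b ∧ does (toℕ (v z) ℕ.<? j)))
    (does-↔ (i ℕ.≤? toℕ z) (suc i ℕ.≤? toℕ z)
       (λ p → NP.≤∧≢⇒< p (λ e → ne (FP.toℕ-injective (trans (sym e) (sym ty)))))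
       NP.<⇒≤))
  (trans (ind-true _ (dec-true (i ℕ.≤? toℕ y) (NP.≤-reflexive (sym ty))))
         (sym (trans (cong (ind (does (toℕ (v y) ℕ.<? j)) +_)
                           (ind-false (dec-false (suc i ℕ.≤? toℕ y) (λ p → NP.<-irrefl (sym ty) p))))
                     (NP.+-identityʳ _))))

highBefore-zero : ∀ {n} (v : Perm n) j → highBefore v 0 j ≡ 0
highBefore-zero {n} v j = sumFin-zero n _ (λ y → ind-false {c = does (j ℕ.≤? toℕ (v y))} (dec-false (toℕ y ℕ.<? 0) (λ ())))

lowFrom-n : ∀ {n} (v : Perm n) j → lowFrom v n j ≡ 0
lowFrom-n {n} v j = sumFin-zero n _ (λ y → ind-false (dec-false (n ℕ.≤? toℕ y) (NP.<⇒≱ (FP.toℕ<n y))))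

highBefore-≤ : ∀ {n} (v : Perm n) i j → i ℕ.≤ n → highBefore v i j ℕ.≤ i
highBefore-≤ v zero j _ = NP.≤-reflexive (highBefore-zero v j)
highBefore-≤ v (suc i) j h = subst (ℕ._≤ suc i) (sym (highBefore-suc v (fromℕ< h) i j (FP.toℕ-fromℕ< h)))
  (NP.+-mono-≤ (ind≤1 _) (highBefore-≤ v i j (NP.<⇒≤ h)))

highBefore-full : ∀ {n} (v : Perm n) i j → i ℕ.≤ n → (∀ y → toℕ y ℕ.< i → j ℕ.≤ toℕ (v y)) → i ℕ.≤ highBefore v i j
highBefore-full v zero j _ _ = z≤n
highBefore-full v (suc i) j h all = subst (suc i ℕ.≤_) (sym (highBefore-suc v y i j ty))
  (subst (λ z → suc i ℕ.≤ z + highBefore v i j)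
         (sym (cong ind (dec-true (j ℕ.≤? toℕ (v y)) (all y (subst (ℕ._< suc i) (sym ty) (NP.n<1+n _))))))
         (s≤s (highBefore-full v i j (NP.<⇒≤ h) (λ z p → all z (NP.<-trans p (NP.n<1+n _))))))
  where
  y = fromℕ< h
  ty = FP.toℕ-fromℕ< h

highBefore-full⁻ : ∀ {n} (v : Perm n) i j → i ℕ.≤ n → i ℕ.≤ highBefore v i j → ∀ y → toℕ y ℕ.< i → j ℕ.≤ toℕ (v y)
highBefore-full⁻ v zero j _ _ y ()
highBefore-full⁻ v (suc i) j h full z z<i =
  by-cases (ind-forced (does (j ℕ.≤? toℕ (v y))) (subst (suc i ℕ.≤_) (highBefore-suc v y i j ty) full)
                       (highBefore-≤ v i j (NP.<⇒≤ h)))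
           (toℕ z ℕ.≟ i)
  where
  y = fromℕ< h
  ty = FP.toℕ-fromℕ< h
  by-cases : does (j ℕ.≤? toℕ (v y)) ≡ true × i ℕ.≤ highBefore v i j → Dec (toℕ z ≡ i) → j ℕ.≤ toℕ (v z)
  by-cases (at-y , _) (yes e) =
    subst (λ w → j ℕ.≤ toℕ (v w)) (FP.toℕ-injective (trans ty (sym e))) (does-true→ (j ℕ.≤? toℕ (v y)) at-y)
  by-cases (_ , rest) (no ne) = highBefore-full⁻ v i j (NP.<⇒≤ h) rest z (NP.≤∧≢⇒< (NP.≤-pred z<i) ne)

lowFrom-≤ : ∀ {n} (v : Perm n) t i j → i + t ≡ n → lowFrom v i j ℕ.≤ t
lowFrom-≤ v zero i j e =
  NP.≤-reflexive (trans (cong (λ z → lowFrom v z j) (trans (sym (NP.+-identityʳ i)) e)) (lowFrom-n v j))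
lowFrom-≤ {n} v (suc t) i j e = subst (ℕ._≤ suc t) (sym (lowFrom-pred v (fromℕ< h) i j (FP.toℕ-fromℕ< h)))
  (NP.+-mono-≤ (ind≤1 _) (lowFrom-≤ v t (suc i) j (trans (sym (NP.+-suc i t)) e)))
  where
  h : i ℕ.< n
  h = subst (i ℕ.<_) e (NP.m<m+n i (s≤s z≤n))

lowFrom-full : ∀ {n} (v : Perm n) t i j → i + t ≡ n → (∀ y → i ℕ.≤ toℕ y → toℕ (v y) ℕ.< j) → t ℕ.≤ lowFrom v i j
lowFrom-full v zero i j e all = z≤n
lowFrom-full {n} v (suc t) i j e all = subst (suc t ℕ.≤_) (sym (lowFrom-pred v y i j ty))
  (subst (λ z → suc t ℕ.≤ z + lowFrom v (suc i) j)
         (sym (cong ind (dec-true (toℕ (v y) ℕ.<? j) (all y (NP.≤-reflexive (sym ty))))))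
         (s≤s (lowFrom-full v t (suc i) j (trans (sym (NP.+-suc i t)) e) (λ z p → all z (NP.<⇒≤ p)))))
  where
  h : i ℕ.< n
  h = subst (i ℕ.<_) e (NP.m<m+n i (s≤s z≤n))
  y = fromℕ< h
  ty = FP.toℕ-fromℕ< h

lowFrom-full⁻ : ∀ {n} (v : Perm n) t i j → i + t ≡ n → t ℕ.≤ lowFrom v i j → ∀ y → i ℕ.≤ toℕ y → toℕ (v y) ℕ.< j
lowFrom-full⁻ v zero i j e _ z i≤z =
  ⊥-elim (NP.<⇒≱ (FP.toℕ<n z) (subst (ℕ._≤ toℕ z) (trans (sym (NP.+-identityʳ i)) e) i≤z))
lowFrom-full⁻ {n} v (suc t) i j e full z i≤z =
  by-cases (ind-forced (does (toℕ (v y) ℕ.<? j)) (subst (suc t ℕ.≤_) (lowFrom-pred v y i j ty) full)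
                       (lowFrom-≤ v t (suc i) j e′))
           (toℕ z ℕ.≟ i)
  where
  h : i ℕ.< n
  h = subst (i ℕ.<_) e (NP.m<m+n i (s≤s z≤n))
  y = fromℕ< h
  ty = FP.toℕ-fromℕ< h
  e′ = trans (sym (NP.+-suc i t)) e
  by-cases : does (toℕ (v y) ℕ.<? j) ≡ true × t ℕ.≤ lowFrom v (suc i) j → Dec (toℕ z ≡ i) → toℕ (v z) ℕ.< j
  by-cases (at-y , _) (yes eq) =
    subst (λ w → toℕ (v w) ℕ.< j) (FP.toℕ-injective (trans ty (sym eq))) (does-true→ (toℕ (v y) ℕ.<? j) at-y)
  by-cases (_ , rest) (no ne) = lowFrom-full⁻ v t (suc i) j e′ rest z (NP.≤∧≢⇒< i≤z (λ q → ne (sym q)))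

dominated-high : ∀ {n} {u w : Perm n} → Dominated u w → ∀ p j → p ℕ.≤ n →
  (∀ y → toℕ y ℕ.< p → j ℕ.≤ toℕ (u y)) → ∀ y → toℕ y ℕ.< p → j ℕ.≤ toℕ (w y)
dominated-high {u = u} {w} dom p j p≤n all-u =
  highBefore-full⁻ w p j p≤n (NP.≤-trans (highBefore-full u p j p≤n all-u) (proj₁ (dom p j)))

dominated-low : ∀ {n} {u w : Perm n} → Dominated u w → ∀ p j → p ℕ.≤ n →
  (∀ y → p ℕ.≤ toℕ y → toℕ (u y) ℕ.< j) → ∀ y → p ℕ.≤ toℕ y → toℕ (w y) ℕ.< j
dominated-low {n} {u} {w} dom p j p≤n all-u =
  lowFrom-full⁻ w (n ∸ p) p j (NP.m+[n∸m]≡n p≤n)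
    (NP.≤-trans (lowFrom-full u (n ∸ p) p j (NP.m+[n∸m]≡n p≤n) all-u) (proj₂ (dom p j)))

-- The inequality at the only index whose counts change under a common
-- ascent: the counts of the two positions involved are b, a (for u) and
-- d, c (for w), with d false forcing c false; from the bounds x ≤ y before
-- both positions and b + a + x ≤ d + c + y after them, the bound in the
-- middle after the exchange, b + x ≤ d + y, follows.
count-step : ∀ (a b c d : Bool) {x y} → (d ≡ false → c ≡ false) → x ℕ.≤ y →
             ind b + (ind a + x) ℕ.≤ ind d + (ind c + y) → ind b + x ℕ.≤ ind d + y
count-step a false c d {x} {y} _ le _ = NP.≤-trans le (NP.m≤n+m y (ind d))
count-step a true c true _ le _ = s≤s le
count-step a true false false {x} {y} _ le (s≤s big) = s≤s (NP.≤-trans (NP.m≤n+m x (ind a)) big)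
count-step a true true false d⇒c le big with d⇒c refl
... | ()

module DominationStep {n} (l : Letter n) where
  r = toℕ (lo l)

  r≢suc : r ≢ suc r
  r≢suc e = NP.<-irrefl e (NP.n<1+n r)

  suc-suc≢suc : suc (suc r) ≢ suc r
  suc-suc≢suc e = NP.<-irrefl (sym e) (NP.n<1+n (suc r))

  atLeast : ℕ → Fin n → Bool
  atLeast j c = does (j ℕ.≤? toℕ c)

  below : Fin n → ℕ → Bool
  below c j = does (toℕ c ℕ.<? j)

  highBefore-moved : ∀ (v : Perm n) j → highBefore (v · sgen l) (suc r) j ≡ ind (atLeast j (v (hi l))) + highBefore v r j
  highBefore-moved v j = trans (highBefore-suc (v · sgen l) (lo l) r j refl)
    (cong₂ _+_ (cong (λ c → ind (atLeast j c)) (cong v (trans (sgen-swap l (lo l)) (swap-left (lo l) (hi l)))))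
               (highBefore-sgen v l r j r≢suc))

  highBefore-lo : ∀ (v : Perm n) j → highBefore v (suc r) j ≡ ind (atLeast j (v (lo l))) + highBefore v r j
  highBefore-lo v j = highBefore-suc v (lo l) r j refl

  highBefore-hi : ∀ (v : Perm n) j →
    highBefore v (suc (suc r)) j ≡ ind (atLeast j (v (hi l))) + (ind (atLeast j (v (lo l))) + highBefore v r j)
  highBefore-hi v j = trans (highBefore-suc v (hi l) (suc r) j (toℕ-hi l)) (cong (ind (atLeast j (v (hi l))) +_) (highBefore-lo v j))

  lowFrom-moved : ∀ (v : Perm n) j → lowFrom (v · sgen l) (suc r) j ≡ ind (below (v (lo l)) j) + lowFrom v (suc (suc r)) j
  lowFrom-moved v j = trans (lowFrom-pred (v · sgen l) (hi l) (suc r) j (toℕ-hi l))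
    (cong₂ _+_ (cong (λ c → ind (below c j)) (cong v (trans (sgen-swap l (hi l)) (swap-right (lo l) (hi l)))))
               (lowFrom-sgen v l (suc (suc r)) j suc-suc≢suc))

  lowFrom-hi : ∀ (v : Perm n) j → lowFrom v (suc r) j ≡ ind (below (v (hi l)) j) + lowFrom v (suc (suc r)) j
  lowFrom-hi v j = lowFrom-pred v (hi l) (suc r) j (toℕ-hi l)

  lowFrom-lo : ∀ (v : Perm n) j →
    lowFrom v r j ≡ ind (below (v (lo l)) j) + (ind (below (v (hi l)) j) + lowFrom v (suc (suc r)) j)
  lowFrom-lo v j = trans (lowFrom-pred v (lo l) r j refl) (cong (ind (below (v (lo l)) j) +_) (lowFrom-hi v j))

  ascent-atLeast : ∀ (v : Perm n) j → Ascent v l → atLeast j (v (hi l)) ≡ false → atLeast j (v (lo l)) ≡ false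
  ascent-atLeast v j up e = dec-false (j ℕ.≤? toℕ (v (lo l)))
    (λ p → does-false→ (j ℕ.≤? toℕ (v (hi l))) e (NP.≤-trans p (NP.<⇒≤ up)))

  ascent-below : ∀ (v : Perm n) j → Ascent v l → below (v (lo l)) j ≡ false → below (v (hi l)) j ≡ false
  ascent-below v j up e = dec-false (toℕ (v (hi l)) ℕ.<? j)
    (λ p → does-false→ (toℕ (v (lo l)) ℕ.<? j) e (NP.<-trans up p))

  both : ∀ (u w : Perm n) → Ascent w l → Dominated u w → Dominated (u · sgen l) (w · sgen l)
  both u w up-w dom i j with i ℕ.≟ suc r
  ... | no ne = subst₂ ℕ._≤_ (sym (highBefore-sgen u l i j ne)) (sym (highBefore-sgen w l i j ne)) (proj₁ (dom i j)) ,
                subst₂ ℕ._≤_ (sym (lowFrom-sgen u l i j ne)) (sym (lowFrom-sgen w l i j ne)) (proj₂ (dom i j))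
  ... | yes refl =
    subst₂ ℕ._≤_ (sym (highBefore-moved u j)) (sym (highBefore-moved w j))
      (count-step (atLeast j (u (lo l))) (atLeast j (u (hi l))) (atLeast j (w (lo l))) (atLeast j (w (hi l)))
                  (ascent-atLeast w j up-w) (proj₁ (dom r j))
                  (subst₂ ℕ._≤_ (highBefore-hi u j) (highBefore-hi w j) (proj₁ (dom (suc (suc r)) j)))) ,
    subst₂ ℕ._≤_ (sym (lowFrom-moved u j)) (sym (lowFrom-moved w j))
      (count-step (below (u (hi l)) j) (below (u (lo l)) j) (below (w (hi l)) j) (below (w (lo l)) j)
                  (ascent-below w j up-w) (proj₂ (dom (suc (suc r)) j))
                  (subst₂ ℕ._≤_ (lowFrom-lo u j) (lowFrom-lo w j) (proj₂ (dom r j))))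

  larger : ∀ (u w : Perm n) → Ascent w l → Dominated u w → Dominated u (w · sgen l)
  larger u w up-w dom i j with i ℕ.≟ suc r
  ... | no ne = subst (highBefore u i j ℕ.≤_) (sym (highBefore-sgen w l i j ne)) (proj₁ (dom i j)) ,
                subst (lowFrom u i j ℕ.≤_) (sym (lowFrom-sgen w l i j ne)) (proj₂ (dom i j))
  ... | yes refl =
    NP.≤-trans (proj₁ (dom (suc r) j))
      (subst₂ ℕ._≤_ (sym (highBefore-lo w j)) (sym (highBefore-moved w j))
        (NP.+-monoˡ-≤ (highBefore w r j) (ind-mono _ _ (λ e → dec-true (j ℕ.≤? toℕ (w (hi l)))
                 (NP.≤-trans (does-true→ (j ℕ.≤? toℕ (w (lo l))) e) (NP.<⇒≤ up-w)))))) ,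
    NP.≤-trans (proj₂ (dom (suc r) j))
      (subst₂ ℕ._≤_ (sym (lowFrom-hi w j)) (sym (lowFrom-moved w j))
        (NP.+-monoˡ-≤ (lowFrom w (suc (suc r)) j) (ind-mono _ _ (λ e → dec-true (toℕ (w (lo l)) ℕ.<? j)
                 (NP.<-trans up-w (does-true→ (toℕ (w (hi l)) ℕ.<? j) e))))))

-- Along an ascending diagram whose word is ascending as well, domination of
-- the subexpression product by the word product is preserved; from the
-- identity this is the counting form of u ≤ w.
dominated-along : ∀ {n} (u w : Perm n) D → Dominated u w → AscendingDiagram u D → AscendingWord w (word D) →
                  Dominated (finalU u D) (mulWord w (word D))
dominated-along u w [] dom _ _ = dom
dominated-along u w ((l , true) ∷ D) dom (_ , asc-u) (up-w , asc-w) =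
  dominated-along (u · sgen l) (w · sgen l) D (DominationStep.both l u w up-w dom) asc-u asc-w
dominated-along u w ((l , false) ∷ D) dom (_ , asc-u) (up-w , asc-w) =
  dominated-along u (w · sgen l) D (DominationStep.larger l u w up-w dom) asc-u asc-w

DownClosed : ∀ {n} (P : Fin n → Set) (lo hi : ℕ) → Set
DownClosed P lo hi = ∀ x y → lo ℕ.≤ toℕ x → toℕ x ℕ.< toℕ y → toℕ y ℕ.< hi → P y → P x

Cut : ∀ {n} (P : Fin n → Set) (lo hi : ℕ) → Set
Cut P lo hi = Σ ℕ λ p → lo ℕ.≤ p × p ℕ.≤ hi ×
  (∀ y → lo ℕ.≤ toℕ y → toℕ y ℕ.< p → P y) × (∀ y → p ℕ.≤ toℕ y → toℕ y ℕ.< hi → ¬ P y)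

cut : ∀ {n} (P : Fin n → Set) → (∀ y → Dec (P y)) → ∀ lo d → lo + d ℕ.≤ n →
      DownClosed P lo (lo + d) → Cut P lo (lo + d)
cut P P? lo zero h _ =
  lo , NP.≤-refl , NP.m≤m+n lo 0 ,
  (λ y lo≤y y<lo → ⊥-elim (NP.<-irrefl refl (NP.<-≤-trans y<lo lo≤y))) ,
  (λ y lo≤y y<hi → ⊥-elim (NP.<-irrefl refl (NP.<-≤-trans y<hi (subst (ℕ._≤ toℕ y) (sym (NP.+-identityʳ lo)) lo≤y))))
cut {n} P P? lo (suc d) h down = scan (P? first)
  where
  first : Fin n
  first = fromℕ< (NP.<-≤-trans (NP.m<m+n lo (s≤s z≤n)) h)
  t-first : toℕ first ≡ lo
  t-first = FP.toℕ-fromℕ< _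
  h′ : suc lo + d ℕ.≤ n
  h′ = subst (ℕ._≤ n) (NP.+-suc lo d) h
  hi-eq : suc lo + d ≡ lo + suc d
  hi-eq = sym (NP.+-suc lo d)
  fails-from-first : ∀ y → lo ℕ.≤ toℕ y → toℕ y ℕ.< lo + suc d → P y → P first
  fails-from-first y lo≤y y<hi Py with toℕ y ℕ.≟ lo
  ... | yes e = subst P (FP.toℕ-injective (trans e (sym t-first))) Py
  ... | no ne = down first y (NP.≤-reflexive (sym t-first))
                  (subst (ℕ._< toℕ y) (sym t-first) (NP.≤∧≢⇒< lo≤y (λ e → ne (sym e)))) y<hi Py
  scan : Dec (P first) → Cut P lo (lo + suc d)
  scan (no ¬P-first) =
    lo , NP.≤-refl , NP.m≤m+n lo (suc d) ,
    (λ y lo≤y y<lo → ⊥-elim (NP.<-irrefl refl (NP.<-≤-trans y<lo lo≤y))) ,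
    (λ y lo≤y y<hi Py → ¬P-first (fails-from-first y lo≤y y<hi Py))
  scan (yes P-first) with cut P P? (suc lo) d h′
                            (λ x y lo<x x<y y<hi → down x y (NP.<⇒≤ lo<x) x<y (subst (toℕ y ℕ.<_) hi-eq y<hi))
  ... | p , lo<p , p≤hi , holds , fails = p , NP.<⇒≤ lo<p , subst (p ℕ.≤_) hi-eq p≤hi , holds′ , fails′
    where
    holds′ : ∀ y → lo ℕ.≤ toℕ y → toℕ y ℕ.< p → P y
    holds′ y lo≤y y<p with toℕ y ℕ.≟ lo
    ... | yes e = subst P (FP.toℕ-injective (trans t-first (sym e))) P-first
    ... | no ne = holds y (NP.≤∧≢⇒< lo≤y (λ e → ne (sym e))) y<p
    fails′ : ∀ y → p ℕ.≤ toℕ y → toℕ y ℕ.< lo + suc d → ¬ P y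
    fails′ y p≤y y<hi = fails y p≤y (subst (toℕ y ℕ.<_) (sym hi-eq) y<hi)

cut-between : ∀ {n} (P : Fin n → Set) → (∀ y → Dec (P y)) → ∀ lo hi → lo ℕ.≤ hi → hi ℕ.≤ n →
              DownClosed P lo hi → Cut P lo hi
cut-between P P? lo hi lo≤hi hi≤n down =
  subst (Cut P lo) (NP.m+[n∸m]≡n lo≤hi)
    (cut P P? lo (hi ∸ lo) (subst (ℕ._≤ _) (sym (NP.m+[n∸m]≡n lo≤hi)) hi≤n)
         (subst (DownClosed P lo) (sym (NP.m+[n∸m]≡n lo≤hi)) down))

graft-reverses : ∀ {n} (P q : Fin (suc n)) (U : Perm n) (x y : Fin (suc n)) → x F.< y →
  (∀ x′ y′ → x ≡ punchIn P x′ → y ≡ punchIn P y′ → x′ F.< y′ → U y′ F.< U x′) →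
  (∀ y′ → x ≡ P → y ≡ punchIn P y′ → toℕ P ℕ.≤ toℕ y′ → toℕ (U y′) ℕ.< toℕ q) →
  (∀ x′ → y ≡ P → x ≡ punchIn P x′ → toℕ x′ ℕ.< toℕ P → toℕ q ℕ.≤ toℕ (U x′)) →
  graft P q U y F.< graft P q U x
graft-reverses P q U x y x<y both-old x-new y-new with punchIn-view P x | punchIn-view P y
... | inj₁ ex | inj₁ ey = ⊥-elim (NP.<-irrefl (cong toℕ (trans ex (sym ey))) x<y)
... | inj₁ ex | inj₂ (y′ , ey) =
  subst₂ F._<_ (sym (trans (cong (graft P q U) ey) (graft-punchIn P q U y′)))
               (sym (trans (cong (graft P q U) ex) (graft-at P q U)))
    (punchIn<q q (U y′) (x-new y′ ex ey P≤y′))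
  where
  P≤y′ : toℕ P ℕ.≤ toℕ y′
  P≤y′ with punchIn-cases P y′
  ... | inj₂ (r , _) = r
  ... | inj₁ (r , t) = ⊥-elim (NP.<-asym r (subst₂ ℕ._<_ (cong toℕ ex) (trans (cong toℕ ey) t) x<y))
... | inj₂ (x′ , ex) | inj₁ ey =
  subst₂ F._<_ (sym (trans (cong (graft P q U) ey) (graft-at P q U)))
               (sym (trans (cong (graft P q U) ex) (graft-punchIn P q U x′)))
    (q<punchIn q (U x′) (y-new x′ ey ex x′<P))
  where
  x′<P : toℕ x′ ℕ.< toℕ P
  x′<P with punchIn-cases P x′
  ... | inj₁ (r , _) = r
  ... | inj₂ (r , t) = ⊥-elim (NP.<-asym (s≤s r) (subst₂ ℕ._<_ (trans (cong toℕ ex) t) (cong toℕ ey) x<y))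
... | inj₂ (x′ , ex) | inj₂ (y′ , ey) =
  subst₂ F._<_ (sym (trans (cong (graft P q U) ey) (graft-punchIn P q U y′)))
               (sym (trans (cong (graft P q U) ex) (graft-punchIn P q U x′)))
    (punchIn-mono q (U y′) (U x′) (both-old x′ y′ ex ey (punchIn-reflects P x′ y′ (subst₂ F._<_ ex ey x<y))))

antiGrassmannian-graft-white : ∀ {n} k (U : Perm n) (P q : Fin (suc n)) → AntiGrassmannian k n U → toℕ P ℕ.≤ k →
  (∀ y → toℕ y ℕ.< toℕ P → toℕ q ℕ.≤ toℕ (U y)) →
  (∀ y → toℕ P ℕ.≤ toℕ y → toℕ y ℕ.< k → toℕ (U y) ℕ.< toℕ q) →
  AntiGrassmannian (suc k) (suc n) (graft P q U)
antiGrassmannian-graft-white k U P q (first-dec , last-dec) P≤k high low = first-dec′ , last-dec′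
  where
  first-dec′ : ∀ x y → x F.< y → toℕ y ℕ.< suc k → graft P q U y F.< graft P q U x
  first-dec′ x y x<y y<k = graft-reverses P q U x y x<y
    (λ x′ y′ ex ey x′<y′ → first-dec x′ y′ x′<y′ (old-y<k y′ ey))
    (λ y′ ex ey P≤y′ → low y′ P≤y′ (old-y<k y′ ey))
    (λ x′ ey ex x′<P → high x′ x′<P)
    where
    old-y<k : ∀ y′ → y ≡ punchIn P y′ → toℕ y′ ℕ.< k
    old-y<k y′ ey with punchIn-cases P y′
    ... | inj₁ (r , _) = NP.<-≤-trans r P≤k
    ... | inj₂ (_ , t) = NP.≤-pred (subst (ℕ._< suc k) (trans (cong toℕ ey) t) y<k)
  last-dec′ : ∀ x y → x F.< y → suc k ℕ.≤ toℕ x → graft P q U y F.< graft P q U x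
  last-dec′ x y x<y k<x = graft-reverses P q U x y x<y
    (λ x′ y′ ex ey x′<y′ → last-dec x′ y′ x′<y′ (k≤old-x x′ ex))
    (λ y′ ex ey P≤y′ → ⊥-elim (NP.<-irrefl refl (NP.<-≤-trans (subst (suc k ℕ.≤_) (cong toℕ ex) k<x) P≤k)))
    (λ x′ ey ex x′<P → ⊥-elim (NP.<-irrefl refl
       (NP.<-≤-trans (NP.<-trans k<x x<y) (NP.≤-trans (NP.≤-reflexive (cong toℕ ey)) P≤k))))
    where
    k≤old-x : ∀ x′ → x ≡ punchIn P x′ → k ℕ.≤ toℕ x′
    k≤old-x x′ ex with punchIn-cases P x′
    ... | inj₁ (r , t) = ⊥-elim (NP.<-irrefl refl
                            (NP.<-≤-trans (NP.<-trans (subst (suc k ℕ.≤_) (trans (cong toℕ ex) t) k<x) r) P≤k))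
    ... | inj₂ (_ , t) = NP.≤-pred (subst (suc k ℕ.≤_) (trans (cong toℕ ex) t) k<x)

antiGrassmannian-graft-black : ∀ {n} k (U : Perm n) (P q : Fin (suc n)) → AntiGrassmannian k n U → k ℕ.≤ toℕ P →
  (∀ y → k ℕ.≤ toℕ y → toℕ y ℕ.< toℕ P → toℕ q ℕ.≤ toℕ (U y)) →
  (∀ y → toℕ P ℕ.≤ toℕ y → toℕ (U y) ℕ.< toℕ q) →
  AntiGrassmannian k (suc n) (graft P q U)
antiGrassmannian-graft-black k U P q (first-dec , last-dec) k≤P high low = first-dec′ , last-dec′
  where
  first-dec′ : ∀ x y → x F.< y → toℕ y ℕ.< k → graft P q U y F.< graft P q U x
  first-dec′ x y x<y y<k = graft-reverses P q U x y x<y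
    (λ x′ y′ ex ey x′<y′ → first-dec x′ y′ x′<y′ (NP.≤-<-trans (punchIn-≥ P y′) (subst (ℕ._< k) (cong toℕ ey) y<k)))
    (λ y′ ex ey P≤y′ → ⊥-elim (NP.<-irrefl refl
       (NP.<-≤-trans (NP.<-trans (subst (ℕ._< toℕ y) (cong toℕ ex) x<y) y<k) k≤P)))
    (λ x′ ey ex x′<P → ⊥-elim (NP.<-irrefl refl (NP.<-≤-trans (subst (ℕ._< k) (cong toℕ ey) y<k) k≤P)))
  last-dec′ : ∀ x y → x F.< y → k ℕ.≤ toℕ x → graft P q U y F.< graft P q U x
  last-dec′ x y x<y k≤x = graft-reverses P q U x y x<y
    (λ x′ y′ ex ey x′<y′ → last-dec x′ y′ x′<y′ (k≤old-x x′ ex))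
    (λ y′ ex ey P≤y′ → low y′ P≤y′)
    (λ x′ ey ex x′<P → high x′ (subst (k ℕ.≤_) (trans (cong toℕ ex) (punchIn-below P x′ x′<P)) k≤x) x′<P)
    where
    k≤old-x : ∀ x′ → x ≡ punchIn P x′ → k ℕ.≤ toℕ x′
    k≤old-x x′ ex with punchIn-cases P x′
    ... | inj₁ (r , t) = subst (k ℕ.≤_) (trans (cong toℕ ex) t) k≤x
    ... | inj₂ (r , _) = NP.≤-trans k≤P r

FirstImage : ∀ {n} (k : ℕ) (μ : Subset n) (U : Perm n) → Set
FirstImage {n} k μ U = ∀ c → (c Sub.∈ μ) ⇔ (∃ λ x → (toℕ x ℕ.< k) × (U x ≡ c))

∈→lookup : ∀ {n} {c : Fin n} {μ : Subset n} → c Sub.∈ μ → lookup μ c ≡ true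
∈→lookup = VP.[]=⇒lookup

lookup→∈ : ∀ {n} {c : Fin n} {μ : Subset n} → lookup μ c ≡ true → c Sub.∈ μ
lookup→∈ {c = c} {μ} = VP.lookup⇒[]= c μ

firstImage-graft-white : ∀ {n} k (μ : Subset n) (U : Perm n) (P q : Fin (suc n)) → toℕ P ℕ.≤ k →
  FirstImage k μ U → FirstImage (suc k) (insertAt μ q Sub.inside) (graft P q U)
firstImage-graft-white k μ U P q P≤k img c = mk⇔ to from
  where
  μ′ = insertAt μ q Sub.inside
  to : c Sub.∈ μ′ → ∃ λ x → (toℕ x ℕ.< suc k) × (graft P q U x ≡ c)
  to c∈ with punchIn-view q c
  ... | inj₁ ec = P , s≤s P≤k , trans (graft-at P q U) (sym ec)
  ... | inj₂ (c′ , ec) =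
    let c′∈ : c′ Sub.∈ μ
        c′∈ = lookup→∈ (trans (sym (VP.insertAt-punchIn μ q Sub.inside c′))
                              (trans (cong (lookup μ′) (sym ec)) (∈→lookup c∈)))
        (x , x<k , ux) = Equivalence.to (img c′) c′∈
    in punchIn P x , NP.≤-<-trans (punchIn-≤suc P x) (s≤s x<k) ,
       trans (graft-punchIn P q U x) (trans (cong (punchIn q) ux) (sym ec))
  from : (∃ λ x → (toℕ x ℕ.< suc k) × (graft P q U x ≡ c)) → c Sub.∈ μ′
  from (x , x<k , e) with punchIn-view P x
  ... | inj₁ ex = lookup→∈ (trans (cong (lookup μ′) (trans (sym e) (trans (cong (graft P q U) ex) (graft-at P q U))))
                                  (VP.insertAt-lookup μ q Sub.inside))
  ... | inj₂ (x′ , ex) =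
    lookup→∈ (trans (cong (lookup μ′) (trans (sym e) (trans (cong (graft P q U) ex) (graft-punchIn P q U x′))))
             (trans (VP.insertAt-punchIn μ q Sub.inside (U x′))
                    (∈→lookup (Equivalence.from (img (U x′)) (x′ , x′<k , refl)))))
    where
    x′<k : toℕ x′ ℕ.< k
    x′<k with punchIn-cases P x′
    ... | inj₁ (r , _) = NP.<-≤-trans r P≤k
    ... | inj₂ (_ , t) = NP.≤-pred (subst (ℕ._< suc k) (trans (cong toℕ ex) t) x<k)

firstImage-graft-black : ∀ {n} k (μ : Subset n) (U : Perm n) (P q : Fin (suc n)) → k ℕ.≤ toℕ P →
  FirstImage k μ U → FirstImage k (insertAt μ q Sub.outside) (graft P q U)
firstImage-graft-black k μ U P q k≤P img c = mk⇔ to from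
  where
  μ′ = insertAt μ q Sub.outside
  to : c Sub.∈ μ′ → ∃ λ x → (toℕ x ℕ.< k) × (graft P q U x ≡ c)
  to c∈ with punchIn-view q c
  ... | inj₁ ec = ⊥-elim (false≢true (trans (sym (VP.insertAt-lookup μ q Sub.outside))
                                           (trans (cong (lookup μ′) (sym ec)) (∈→lookup c∈))))
    where
    false≢true : false ≢ true
    false≢true ()
  ... | inj₂ (c′ , ec) =
    let c′∈ : c′ Sub.∈ μ
        c′∈ = lookup→∈ (trans (sym (VP.insertAt-punchIn μ q Sub.outside c′))
                              (trans (cong (lookup μ′) (sym ec)) (∈→lookup c∈)))
        (x , x<k , ux) = Equivalence.to (img c′) c′∈
    in punchIn P x , subst (ℕ._< k) (sym (punchIn-below P x (NP.<-≤-trans x<k k≤P))) x<k ,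
       trans (graft-punchIn P q U x) (trans (cong (punchIn q) ux) (sym ec))
  from : (∃ λ x → (toℕ x ℕ.< k) × (graft P q U x ≡ c)) → c Sub.∈ μ′
  from (x , x<k , e) with punchIn-view P x
  ... | inj₁ ex = ⊥-elim (NP.<-irrefl refl (NP.<-≤-trans (subst (ℕ._< k) (cong toℕ ex) x<k) k≤P))
  ... | inj₂ (x′ , ex) =
    lookup→∈ (trans (cong (lookup μ′) (trans (sym e) (trans (cong (graft P q U) ex) (graft-punchIn P q U x′))))
             (trans (VP.insertAt-punchIn μ q Sub.outside (U x′))
                    (∈→lookup (Equivalence.from (img (U x′))
                      (x′ , NP.≤-<-trans (punchIn-≥ P x′) (subst (ℕ._< k) (cong toℕ ex) x<k) , refl)))))

antiGrassmannian-cong : ∀ {k n} {f g : Perm n} → f ≗ g → AntiGrassmannian k n f → AntiGrassmannian k n g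
antiGrassmannian-cong e (first-dec , last-dec) =
  (λ x y x<y y<k → subst₂ F._<_ (e y) (e x) (first-dec x y x<y y<k)) ,
  (λ x y x<y k≤x → subst₂ F._<_ (e y) (e x) (last-dec x y x<y k≤x))

firstImage-cong : ∀ {k n} {μ : Subset n} {f g : Perm n} → f ≗ g → FirstImage k μ f → FirstImage k μ g
firstImage-cong e img c =
  mk⇔ (λ c∈ → let (x , x<k , fx) = Equivalence.to (img c) c∈ in x , x<k , trans (sym (e x)) fx)
      (λ { (x , x<k , gx) → Equivalence.from (img c) (x , x<k , trans (e x) gx) })

module Extension {n} (D : Diagram n) (asc-w : AscendingWord idP (word D)) (asc-u : AscendingDiagram idP D)
                 {p : Fin (suc n)} (lift : LetterLift n p) (q : Fin (suc n))
                 (pre suf : List (Letter (suc n))) (P′ : Fin (suc n))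
                 (pre-slides : Slides idP pre (graft p q idP))
                 (suf-slides-W : Slides (graft p q (mulWord idP (word D))) suf (graft P′ q (mulWord idP (word D))))
                 (suf-slides-U : Slides (graft p q (subexprProd D)) suf (graft P′ q (subexprProd D))) where
  open LetterLift lift
  open GraftedDiagram lift q

  U = subexprProd D
  W = mulWord idP (word D)

  D′ : Diagram (suc n)
  D′ = allInJ pre ++ (liftDiagram D ++ allInJ suf)

  word-D′ : word D′ ≡ pre ++ (map liftL (word D) ++ suf)
  word-D′ = trans (LP.map-++ proj₁ (allInJ pre) (liftDiagram D ++ allInJ suf))
    (cong₂ _++_ (word-allInJ pre)
           (trans (LP.map-++ proj₁ (liftDiagram D) (allInJ suf)) (cong₂ _++_ (word-lift D) (word-allInJ suf))))

  W-after-lift : mulWord (mulWord idP pre) (map liftL (word D)) ≗ graft p q W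
  W-after-lift x = trans (mulWord-cong (map liftL (word D)) (proj₂ pre-slides) x) (mulWord-lift idP (word D) x)

  reduced : IsReduced (word D′)
  reduced = ascending→reduced (word D′) (subst (AscendingWord idP) (sym word-D′)
    (ascendingWord-++ idP pre _ (proj₁ pre-slides)
      (ascendingWord-++ (mulWord idP pre) (map liftL (word D)) suf
         (ascendingWord-cong (map liftL (word D)) (≗-sym (proj₂ pre-slides)) (ascendingWord-lift idP (word D) asc-w))
         (ascendingWord-cong suf (≗-sym W-after-lift) (proj₁ suf-slides-W)))))

  U-after-pre = finalU idP (allInJ pre)
  U-after-lift = finalU U-after-pre (liftDiagram D)

  U-after-pre-graft : U-after-pre ≗ graft p q idP
  U-after-pre-graft x = trans (cong (λ f → f x) (finalU-allInJ idP pre)) (proj₂ pre-slides x)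

  U-after-lift-graft : U-after-lift ≗ graft p q U
  U-after-lift-graft x = trans (finalU-cong (liftDiagram D) U-after-pre-graft x) (finalU-lift idP D x)

  pds : IsPDS D′
  pds = ascending→PDS idP D′
    (ascendingDiagram-++ idP (allInJ pre) (liftDiagram D ++ allInJ suf)
      (ascendingDiagram-allInJ idP pre (proj₁ pre-slides))
      (ascendingDiagram-++ U-after-pre (liftDiagram D) (allInJ suf)
         (ascendingDiagram-cong (liftDiagram D) (≗-sym U-after-pre-graft) (ascendingDiagram-lift idP D asc-u))
         (ascendingDiagram-allInJ U-after-lift suf
            (ascendingWord-cong suf (≗-sym U-after-lift-graft) (proj₁ suf-slides-U)))))

  product : subexprProd D′ ≗ graft P′ q U
  product x =
    trans (cong (λ f → f x) (trans (finalU-++ idP (allInJ pre) (liftDiagram D ++ allInJ suf))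
                             (trans (finalU-++ U-after-pre (liftDiagram D) (allInJ suf))
                                    (finalU-allInJ U-after-lift suf))))
          (trans (mulWord-cong suf U-after-lift-graft x) (proj₂ suf-slides-U x))

  bridgesFrom-D′ : bridgesFrom idP D′ ≡ shiftBridges q (bridgesFrom idP D)
  bridgesFrom-D′ =
    begin
      bridgesFrom idP D′
    ≡⟨ bridgesFrom-++ idP (allInJ pre) (liftDiagram D ++ allInJ suf) ⟩
      bridgesFrom idP (allInJ pre) ++ bridgesFrom U-after-pre (liftDiagram D ++ allInJ suf)
    ≡⟨ cong₂ _++_ (bridgesFrom-allInJ idP pre) (bridgesFrom-++ U-after-pre (liftDiagram D) (allInJ suf)) ⟩
      bridgesFrom U-after-pre (liftDiagram D) ++ bridgesFrom U-after-lift (allInJ suf)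
    ≡⟨ cong (bridgesFrom U-after-pre (liftDiagram D) ++_) (bridgesFrom-allInJ U-after-lift suf) ⟩
      bridgesFrom U-after-pre (liftDiagram D) ++ []
    ≡⟨ LP.++-identityʳ _ ⟩
      bridgesFrom U-after-pre (liftDiagram D)
    ≡⟨ bridgesFrom-cong (liftDiagram D) U-after-pre-graft ⟩
      bridgesFrom (graft p q idP) (liftDiagram D)
    ≡⟨ bridgesFrom-lift idP D ⟩
      shiftBridges q (bridgesFrom idP D)
    ∎
    where open ≡-Reasoning

  bridgeSequence-D′ : bridgeSequence D′ ≡ shiftBridges q (bridgeSequence D)
  bridgeSequence-D′ = trans (cong reverse bridgesFrom-D′) (sym (LP.reverse-map _ (bridgesFrom idP D)))

  valid : ∀ {k′} {μ′ : Subset (suc n)} {bs} → bridgeSequence D ≡ bs →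
          AntiGrassmannian k′ (suc n) (graft P′ q U) → FirstImage k′ μ′ (graft P′ q U) →
          HasValidDiagram k′ (suc n) μ′ (shiftBridges q bs)
  valid bs-D ag img =
    D′ , (reduced , pds , antiGrassmannian-cong (≗-sym product) ag) ,
    (firstImage-cong (≗-sym product) img , trans bridgeSequence-D′ (cong (shiftBridges q) bs-D))

slide-to-first : ∀ {n} (q : Fin (suc n)) (h : 0 + toℕ q ℕ.≤ n) →
                 Slides idP (slideDown 0 (toℕ q) h) (graft F.zero q idP)
slide-to-first q h = slides-cong (slideDown 0 (toℕ q) h) (≗-sym (id-graft q))
  (slideDown-graft (toℕ q) 0 h idP q q refl (λ y _ y<q → y<q) F.zero refl)

slide-to-last : ∀ {n} (q : Fin (suc n)) (h : toℕ q + (n ∸ toℕ q) ℕ.≤ n) →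
                Slides idP (slideUp (toℕ q) (n ∸ toℕ q) h) (graft (fromℕ n) q idP)
slide-to-last {n} q h = slides-cong (slideUp (toℕ q) (n ∸ toℕ q) h) (≗-sym (id-graft q))
  (slideUp-graft (n ∸ toℕ q) (toℕ q) h idP q q refl (λ y q≤y _ → q≤y) (fromℕ n)
    (trans (FP.toℕ-fromℕ n) (sym (NP.m+[n∸m]≡n (NP.≤-pred (FP.toℕ<n q))))))

valid-dominated : ∀ {k n} (D : Diagram n) → ValidBridgeDiagram k n D →
                  Dominated (subexprProd D) (mulWord idP (word D))
valid-dominated D (red , pds , _) =
  dominated-along idP idP D (λ i j → NP.≤-refl , NP.≤-refl) (PDS→ascending idP D pds) (reduced→ascending (word D) red)

-- The positions carrying a value at least q: since U decreases on [k] and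
-- on [k+1, n], they form an initial segment of each block, cut here in [k] ...
AtLeast : ∀ {n} → Fin (suc n) → Perm n → Fin n → Set
AtLeast q U y = toℕ q ℕ.≤ toℕ (U y)

white-cut : ∀ {k n} (U : Perm n) → AntiGrassmannian k n U → k ℕ.≤ n → (q : Fin (suc n)) → Cut (AtLeast q U) 0 k
white-cut {k} U ag k≤n q = cut-between (AtLeast q U) (λ y → toℕ q ℕ.≤? toℕ (U y)) 0 k z≤n k≤n
  (λ x y _ x<y y<k q≤Uy → NP.≤-trans q≤Uy (NP.<⇒≤ (proj₁ ag x y x<y y<k)))

-- ... and of [k+1, n].
black-cut : ∀ {k n} (U : Perm n) → AntiGrassmannian k n U → k ℕ.≤ n → (q : Fin (suc n)) → Cut (AtLeast q U) k n
black-cut {k} {n} U ag k≤n q = cut-between (AtLeast q U) (λ y → toℕ q ℕ.≤? toℕ (U y)) k n k≤n NP.≤-refl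
  (λ x y k≤x x<y _ q≤Uy → NP.≤-trans q≤Uy (NP.<⇒≤ (proj₂ ag x y x<y k≤x)))

white-lollipop : ∀ {k n} (μ : Subset n) (bs : List (Bridge n)) (D : Diagram n) → k ℕ.≤ n →
  ValidBridgeDiagram k n D → Corresponds k n D μ bs → (q : Fin (suc n)) →
  HasValidDiagram (suc k) (suc n) (insertAt μ q Sub.inside) (shiftBridges q bs)
white-lollipop {k} {n} μ bs D k≤n valid@(red , pds , ag) (img , bs-D) q
  with white-cut (subexprProd D) ag k≤n q
... | p , _ , p≤k , high , low =
  Extension.valid D (reduced→ascending (word D) red) (PDS→ascending idP D pds) liftFirst q pre suf P′
    (slide-to-first q q≤n) (suf-slides W high-W) (suf-slides U (λ y _ y<p → high y z≤n y<p)) bs-D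
    (antiGrassmannian-graft-white k U P′ q ag P′≤k
       (λ y y<P′ → high y z≤n (subst (toℕ y ℕ.<_) tP′ y<P′))
       (λ y P′≤y y<k → NP.≰⇒> (low y (subst (ℕ._≤ toℕ y) tP′ P′≤y) y<k)))
    (firstImage-graft-white k μ U P′ q P′≤k img)
  where
  U = subexprProd D
  W = mulWord idP (word D)
  q≤n : 0 + toℕ q ℕ.≤ n
  q≤n = NP.≤-pred (FP.toℕ<n q)
  p≤n = NP.≤-trans p≤k k≤n
  P′ = fromℕ< (s≤s p≤n)
  tP′ : toℕ P′ ≡ p
  tP′ = FP.toℕ-fromℕ< (s≤s p≤n)
  P′≤k = subst (ℕ._≤ k) (sym tP′) p≤k
  pre = slideDown 0 (toℕ q) q≤n
  suf = slideUp 0 p p≤n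
  -- the values passed by q on its way up are ≥ q, for U by the cut and for W by domination
  high-W : ∀ y → 0 ℕ.≤ toℕ y → toℕ y ℕ.< p → toℕ q ℕ.≤ toℕ (W y)
  high-W y _ = dominated-high (valid-dominated D valid) p (toℕ q) p≤n (λ y y<p → high y z≤n y<p) y
  suf-slides : ∀ V → (∀ y → 0 ℕ.≤ toℕ y → toℕ y ℕ.< 0 + p → toℕ q ℕ.≤ toℕ (V y)) →
               Slides (graft F.zero q V) suf (graft P′ q V)
  suf-slides V passed = slideUp-graft p 0 p≤n V q F.zero refl passed P′ tP′

black-lollipop : ∀ {k n} (μ : Subset n) (bs : List (Bridge n)) (D : Diagram n) → k ℕ.≤ n →
  ValidBridgeDiagram k n D → Corresponds k n D μ bs → (q : Fin (suc n)) →
  HasValidDiagram k (suc n) (insertAt μ q Sub.outside) (shiftBridges q bs)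
black-lollipop {k} {n} μ bs D k≤n valid@(red , pds , ag) (img , bs-D) q
  with black-cut (subexprProd D) ag k≤n q
... | p , k≤p , p≤n , high , low =
  Extension.valid D (reduced→ascending (word D) red) (PDS→ascending idP D pds) liftLast q pre suf P′
    (slide-to-last q q≤n) (suf-slides W low-W) (suf-slides U (λ y p≤y _ → low-U y p≤y)) bs-D
    (antiGrassmannian-graft-black k U P′ q ag k≤P′
       (λ y k≤y y<P′ → high y k≤y (subst (toℕ y ℕ.<_) tP′ y<P′))
       (λ y P′≤y → low-U y (subst (ℕ._≤ toℕ y) tP′ P′≤y)))
    (firstImage-graft-black k μ U P′ q k≤P′ img)
  where
  U = subexprProd D
  W = mulWord idP (word D)
  q≤n : toℕ q + (n ∸ toℕ q) ℕ.≤ n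
  q≤n = NP.≤-reflexive (NP.m+[n∸m]≡n (NP.≤-pred (FP.toℕ<n q)))
  P′ = fromℕ< (s≤s p≤n)
  tP′ : toℕ P′ ≡ p
  tP′ = FP.toℕ-fromℕ< (s≤s p≤n)
  k≤P′ = subst (k ℕ.≤_) (sym tP′) k≤p
  h : p + (n ∸ p) ℕ.≤ n
  h = NP.≤-reflexive (NP.m+[n∸m]≡n p≤n)
  pre = slideUp (toℕ q) (n ∸ toℕ q) q≤n
  suf = slideDown p (n ∸ p) h
  -- the values passed by q on its way down are < q, for U by the cut and for W by domination
  low-U : ∀ y → p ℕ.≤ toℕ y → toℕ (U y) ℕ.< toℕ q
  low-U y p≤y = NP.≰⇒> (low y p≤y (FP.toℕ<n y))
  low-W : ∀ y → p ℕ.≤ toℕ y → toℕ y ℕ.< p + (n ∸ p) → toℕ (W y) ℕ.< toℕ q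
  low-W y p≤y _ = dominated-low (valid-dominated D valid) p (toℕ q) p≤n low-U y p≤y
  suf-slides : ∀ V → (∀ y → p ℕ.≤ toℕ y → toℕ y ℕ.< p + (n ∸ p) → toℕ (V y) ℕ.< toℕ q) →
               Slides (graft (fromℕ n) q V) suf (graft P′ q V)
  suf-slides V passed =
    slideDown-graft (n ∸ p) p h V q (fromℕ n) (trans (FP.toℕ-fromℕ n) (sym (NP.m+[n∸m]≡n p≤n))) passed P′ tP′

lemma4p1 : (k n : ℕ) (μ : Subset n) (bs : List (Bridge n)) →
    BridgeGraphData k n μ bs →
    HasValidDiagram k n μ bs →
    (q : Fin (suc n)) (white : Bool) →
    HasValidDiagram (lollipopK k white) (suc n)
    (lollipopSubset μ q white) (shiftBridges q bs)
lemma4p1 k n μ bs (∣μ∣≡k , _) (D , valid , corresponds) q = lollipop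
  where
  k≤n : k ℕ.≤ n
  k≤n = subst (ℕ._≤ n) ∣μ∣≡k (SubP.∣p∣≤n μ)
  lollipop : (white : Bool) →
             HasValidDiagram (lollipopK k white) (suc n) (lollipopSubset μ q white) (shiftBridges q bs)
  lollipop true = white-lollipop μ bs D k≤n valid corresponds q
  lollipop false = black-lollipop μ bs D k≤n valid corresponds q
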